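{- Let $r\ge1$ and let $v_1,\dots,v_m$ be vertices of the Kostka polytope $P_r$ with labels $(a_i,b_i,\ell_i)$, $1\le i\le m$. Then the minimal face of $P_r$ containing $v_1,\dots,v_m$ has as its vertices exactly those vertices of $P_r$ whose label $(a,b,\ell)$ satisfies all of: (1) $b\in\{b_1,\dots,b_m\}$; (2) $\ell$ and $a$ both belong to $\bigcup_{i=1}^m\{\ell_i,a_i\}$; (3) the open interval $(\ell,a)$ is contained in $\bigcup_{i=1}^m(\ell_i,a_i)$; (4) $0\le\ell<b<a\le r$ or $a=b=\ell$.
   Context: For a positive integer $r$, a partition with at most $r$ parts is written as a non-increasing $r$-tuple of nonnegative integers; $\mathrm{Par}_r(n)$ is the set of those with entries summing to $n$. For $\lambda,\mu\in\mathrm{Par}_r(n)$, $\lambda$ dominates $\mu$ if $\sum_{i=1}^k\lambda_i\ge\sum_{i=1}^k\mu_i$ for all $k\le r$. The $r$-Kostka cone $\mathcal{K}_r\subseteq\mathbb{R}^{2r}$ is the convex hull of all points $(\lambda_1,\dots,\lambda_r,\mu_1,\dots,\mu_r)$ with $\lambda,\mu\in\mathrm{Par}_r(n)$ for some $n$ and $\lambda$ dominating $\mu$. The Kostka polytope $P_r$ is $\mathcal{K}_r\cap\{x:\sum_{i=1}^r(\lambda_i+\mu_i)=1\}$, whose vertices are the intersections with the extremal rays of $\mathcal{K}_r$. It is known that the extremal rays of $\mathcal{K}_r$ are exactly the rays spanned by the vectors $\big((a-\ell)^b,0^{r-b};\,(a-\ell)^\ell,(b-\ell)^{a-\ell},0^{r-a}\big)$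 for integers $0\le\ell<b\le a\le r$, where exponents denote repetition of an entry. A vertex of $P_r$ on the ray of such a vector with $a\neq b$ (so $0\le\ell<b<a\le r$) is labeled $(a,b,\ell)$; when $a=b$ the ray does not depend on $\ell$, and the vertex is labeled $(a,a,a)$.
   Formalization: The faces of $P_r$ are cut out only by valid linear inequalities with rational coefficients, and the open intervals in condition (3) are taken over ℚ, not over the reals. -}

module Defs where

open import Data.Nat as ℕ using (ℕ; zero; suc; _∸_; _≤ᵇ_; _≡ᵇ_)
open import Data.Fin using (Fin; zero; suc; toℕ)
open import Data.Bool using (if_then_else_)
open import Data.Integer using (+_)
open import Data.Rational as ℚ using (ℚ; 0ℚ; _/_)
open import Data.Product using (_×_; Σ; ∃; ∃-syntax)
open import Data.Sum using (_⊎_)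
open import Relation.Binary.PropositionalEquality using (_≡_)

sumℕ : (n : ℕ) → (Fin n → ℕ) → ℕ
sumℕ zero    f = 0
sumℕ (suc n) f = f zero ℕ.+ sumℕ n (λ j → f (suc j))

sumℚ : (n : ℕ) → (Fin n → ℚ) → ℚ
sumℚ zero    f = 0ℚ
sumℚ (suc n) f = f zero ℚ.+ sumℚ n (λ j → f (suc j))

ι : ℕ → ℚ
ι n = (+ n) / 1

-- w / N (with the convention w / 0 = 0, never used for actual labels)
frac : ℕ → ℕ → ℚ
frac w zero    = 0ℚ
frac w (suc n) = (+ w) / suc n

-- Entries (1-based index i) of the ray generator
--   ((a-ℓ)^b, 0^(r-b) ; (a-ℓ)^ℓ, (b-ℓ)^(a-ℓ), 0^(r-a))
rayλ : ℕ → ℕ → ℕ → ℕ → ℕ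
rayλ a b ℓ i = if i ≤ᵇ b then a ∸ ℓ else 0

rayμ : ℕ → ℕ → ℕ → ℕ → ℕ
rayμ a b ℓ i = if i ≤ᵇ ℓ then a ∸ ℓ else (if i ≤ᵇ a then b ∸ ℓ else 0)

-- Generator of the ray labelled (a,b,ℓ); for a = b the ray does not depend
-- on ℓ, and we use the representative ℓ = 0.
genλ : ℕ → ℕ → ℕ → ℕ → ℕ
genλ a b ℓ = if a ≡ᵇ b then rayλ a a 0 else rayλ a b ℓ

genμ : ℕ → ℕ → ℕ → ℕ → ℕ
genμ a b ℓ = if a ≡ᵇ b then rayμ a a 0 else rayμ a b ℓ

genTotal : (r a b ℓ : ℕ) → ℕ
genTotal r a b ℓ = sumℕ r (λ j → genλ a b ℓ (suc (toℕ j)) ℕ.+ genμ a b ℓ (suc (toℕ j)))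

-- The vertex of P_r with label (a,b,ℓ): the generator normalised so that
-- its coordinates sum to 1.  λ-part and μ-part, indexed by Fin r.
vertexλ : (r a b ℓ : ℕ) → Fin r → ℚ
vertexλ r a b ℓ j = frac (genλ a b ℓ (suc (toℕ j))) (genTotal r a b ℓ)

vertexμ : (r a b ℓ : ℕ) → Fin r → ℚ
vertexμ r a b ℓ j = frac (genμ a b ℓ (suc (toℕ j))) (genTotal r a b ℓ)

IsLabel : (r a b ℓ : ℕ) → Set
IsLabel r a b ℓ = (ℓ ℕ.< b × b ℕ.< a × a ℕ.≤ r) ⊎ (a ≡ b × b ≡ ℓ × 1 ℕ.≤ a × a ℕ.≤ r)

-- A linear inequality  cλ·λ + cμ·μ ≤ d  on R^{2r} (rational coefficients)
record Functional (r : ℕ) : Set where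
  field
    cλ : Fin r → ℚ
    cμ : Fin r → ℚ
    d  : ℚ
open Functional public

eval : {r : ℕ} → Functional r → (a b ℓ : ℕ) → ℚ
eval {r} f a b ℓ =
  sumℚ r (λ j → cλ f j ℚ.* vertexλ r a b ℓ j) ℚ.+ sumℚ r (λ j → cμ f j ℚ.* vertexμ r a b ℓ j)

-- The inequality is valid on P_r (= convex hull of its vertices), so that
-- P_r ∩ {c·x = d} is a face of P_r.
Supporting : (r : ℕ) → Functional r → Set
Supporting r f = ∀ a b ℓ → IsLabel r a b ℓ → eval f a b ℓ ℚ.≤ d f

OnFace : {r : ℕ} → Functional r → (a b ℓ : ℕ) → Set
OnFace f a b ℓ = eval f a b ℓ ≡ d f

Conditions : (m : ℕ) (as bs ls : Fin m → ℕ) (a b ℓ : ℕ) → Set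
Conditions m as bs ls a b ℓ =
  (∃[ i ] b ≡ bs i)
  × (∃[ i ] (ℓ ≡ ls i ⊎ ℓ ≡ as i))
  × (∃[ i ] (a ≡ ls i ⊎ a ≡ as i))
  × (∀ (x : ℚ) → ι ℓ ℚ.< x → x ℚ.< ι a → ∃[ i ] (ι (ls i) ℚ.< x × x ℚ.< ι (as i)))

{-# OPTIONS --safe #-}
-- For a functional f = (cλ, cμ, d) let X(k), Y(k) be the sums of the first k coordinates of
-- cλ - d and cμ - d.  Scaled by the (positive) coordinate sum of the ray generator, f - d at the vertex
-- (a, b, ℓ) equals (a - ℓ)X(b) + (a - b)Y(ℓ) + (b - ℓ)Y(a), and a(X(a) + Y(a)) at (a, a, a).  With ψ = X and
-- φ = -Y, f is supporting iff ψ lies below every chord of φ over [0, r] and below φ itself, and (a, b, ℓ)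
-- is on the face iff ψ(b) touches the chord of φ over [ℓ, a] (ψ(a) = φ(a) for (a, a, a)).
--
-- Minimality: a touching chord is a supporting line of φ, so two touching chords over intervals sharing a
-- unit segment are the same line.  If the intervals (ℓᵢ, aᵢ) cover (ℓ, a), the touching chords through it
-- are therefore one line L; L meets φ at ℓ and a (both among the ℓᵢ, aᵢ) and lies below ψ at b (one of
-- the bᵢ), so the chord of φ over [ℓ, a] is L and touches ψ at b.
--
-- Existence: take X(q) = -(β(q) + K(q)) and Y(q) = K(q) - ε(q), where β and ε indicate q ∉ {bᵢ} and
-- q ∉ {ℓᵢ, aᵢ}, and K(q) = Σ min(k, q) over the integers k outside ⋃(ℓᵢ, aᵢ).  The scaled value at (a, b, ℓ)
-- is then -[(a - ℓ)β(b) + (a - b)ε(ℓ) + (b - ℓ)ε(a) + Σ D(k)] over the same k, where D(k) ≥ 0 is the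
-- concavity defect of min(k, _) over ℓ < b < a, positive exactly for ℓ < k < a.  All terms vanish exactly
-- under conditions (1)-(3).

module Submission where

open import Defs
open import Algebra.Bundles using (CommutativeRing)
import Algebra.Properties.Semiring.Sum as SemiringSum
open import Data.Bool using (true; false; if_then_else_; T)
open import Data.Empty using (⊥-elim)
open import Data.Fin using (Fin; zero; suc; toℕ; fromℕ<)
open import Data.Fin.Properties using (any?; toℕ-fromℕ<)
import Data.Integer as ℤ
import Data.Integer.Properties as ℤP
import Data.Integer.Tactic.RingSolver as ℤ-Solver
open import Data.Nat as ℕ using (ℕ; zero; suc; _∸_; _⊓_; _≤_; _<_; _<ᵇ_; _≡ᵇ_; z≤n; s≤s)
import Data.Nat.Properties as ℕP
import Data.Nat.Tactic.RingSolver as ℕ-Solver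
open import Data.Product using (Σ; ∃-syntax; _×_; _,_; proj₁; proj₂)
open import Data.Rational as ℚ using (ℚ; 0ℚ; 1ℚ; _+_; _*_; _-_; -_)
import Data.Rational.Properties as ℚP
import Data.Rational.Unnormalised as ℚᵘ
import Data.Rational.Unnormalised.Properties as ℚᵘ
open import Data.Sum using (_⊎_; inj₁; inj₂; [_,_]′)
open import Function.Bundles using (_⇔_; mk⇔; Equivalence)
import Function.Properties.Equivalence as ⇔
open import Level using (0ℓ)
open import Relation.Binary.Definitions using (tri<; tri≈; tri>)
open import Relation.Binary.PropositionalEquality
open import Relation.Nullary using (Dec; yes; no)
open import Relation.Nullary.Decidable using (dec⇒maybe; dec-true; dec-false; toSum; _×-dec_; _⊎-dec_)
open import Tactic.RingSolver using (solve-∀)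
open import Tactic.RingSolver.Core.AlmostCommutativeRing using (AlmostCommutativeRing; fromCommutativeRing)

ℚ-ring : AlmostCommutativeRing 0ℓ 0ℓ
ℚ-ring = fromCommutativeRing ℚP.+-*-commutativeRing (λ x → dec⇒maybe (0ℚ ℚ.≟ x))

module ΣQ = SemiringSum (CommutativeRing.semiring ℚP.+-*-commutativeRing)
module ΣN = SemiringSum ℕP.+-*-semiring

ι-toℚᵘ : ∀ n → ℚ.toℚᵘ (ι n) ℚᵘ.≃ ℚᵘ.mkℚᵘ (ℤ.+ n) 0
ι-toℚᵘ n = ℚP.toℚᵘ-fromℚᵘ (ℚᵘ.mkℚᵘ (ℤ.+ n) 0)

ι-+ : ∀ m n → ι (m ℕ.+ n) ≡ ι m + ι n
ι-+ m n = ℚP.toℚᵘ-injective (begin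
  ℚ.toℚᵘ (ι (m ℕ.+ n))                        ≈⟨ ι-toℚᵘ (m ℕ.+ n) ⟩
  ℚᵘ.mkℚᵘ (ℤ.+ (m ℕ.+ n)) 0                   ≈⟨ ℚᵘ.*≡* eq ⟩
  ℚᵘ.mkℚᵘ (ℤ.+ m) 0 ℚᵘ.+ ℚᵘ.mkℚᵘ (ℤ.+ n) 0     ≈⟨ ℚᵘ.+-cong (ι-toℚᵘ m) (ι-toℚᵘ n) ⟨
  ℚ.toℚᵘ (ι m) ℚᵘ.+ ℚ.toℚᵘ (ι n)               ≈⟨ ℚP.toℚᵘ-homo-+ (ι m) (ι n) ⟨
  ℚ.toℚᵘ (ι m + ι n)                           ∎)
  where
  open ℚᵘ.≃-Reasoning
  identity : ∀ x y → (x ℤ.+ y) ℤ.* ℤ.+ 1 ≡ (x ℤ.* ℤ.+ 1 ℤ.+ y ℤ.* ℤ.+ 1) ℤ.* ℤ.+ 1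
  identity = ℤ-Solver.solve-∀
  eq : ℤ.+ (m ℕ.+ n) ℤ.* ℤ.+ 1 ≡ (ℤ.+ m ℤ.* ℤ.+ 1 ℤ.+ ℤ.+ n ℤ.* ℤ.+ 1) ℤ.* ℤ.+ 1
  eq rewrite ℤP.pos-+ m n = identity (ℤ.+ m) (ℤ.+ n)

ι-* : ∀ m n → ι (m ℕ.* n) ≡ ι m * ι n
ι-* m n = ℚP.toℚᵘ-injective (begin
  ℚ.toℚᵘ (ι (m ℕ.* n))                        ≈⟨ ι-toℚᵘ (m ℕ.* n) ⟩
  ℚᵘ.mkℚᵘ (ℤ.+ (m ℕ.* n)) 0                   ≈⟨ ℚᵘ.*≡* (cong (ℤ._* ℤ.+ 1) (ℤP.pos-* m n)) ⟩
  ℚᵘ.mkℚᵘ (ℤ.+ m) 0 ℚᵘ.* ℚᵘ.mkℚᵘ (ℤ.+ n) 0     ≈⟨ ℚᵘ.*-cong (ι-toℚᵘ m) (ι-toℚᵘ n) ⟨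
  ℚ.toℚᵘ (ι m) ℚᵘ.* ℚ.toℚᵘ (ι n)               ≈⟨ ℚP.toℚᵘ-homo-* (ι m) (ι n) ⟨
  ℚ.toℚᵘ (ι m * ι n)                           ∎)
  where open ℚᵘ.≃-Reasoning

frac-ι : ∀ w {n} → 0 < n → frac w n * ι n ≡ ι w
frac-ι w {suc n} _ = ℚP.toℚᵘ-injective (begin
  ℚ.toℚᵘ (frac w (suc n) * ι (suc n))                  ≈⟨ ℚP.toℚᵘ-homo-* (frac w (suc n)) (ι (suc n)) ⟩
  ℚ.toℚᵘ (frac w (suc n)) ℚᵘ.* ℚ.toℚᵘ (ι (suc n))
    ≈⟨ ℚᵘ.*-cong (ℚP.toℚᵘ-fromℚᵘ (ℚᵘ.mkℚᵘ (ℤ.+ w) n)) (ι-toℚᵘ (suc n)) ⟩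
  ℚᵘ.mkℚᵘ (ℤ.+ w) n ℚᵘ.* ℚᵘ.mkℚᵘ (ℤ.+ suc n) 0        ≈⟨ ℚᵘ.*≡* eq ⟩
  ℚᵘ.mkℚᵘ (ℤ.+ w) 0                                    ≈⟨ ι-toℚᵘ w ⟨
  ℚ.toℚᵘ (ι w)                                         ∎)
  where
  open ℚᵘ.≃-Reasoning
  identity : ∀ x y → (x ℤ.* y) ℤ.* ℤ.+ 1 ≡ x ℤ.* y
  identity = ℤ-Solver.solve-∀
  eq : (ℤ.+ w ℤ.* ℤ.+ suc n) ℤ.* ℤ.+ 1 ≡ ℤ.+ w ℤ.* ℤ.+ (suc n ℕ.* 1)
  eq rewrite ℕP.*-identityʳ n = identity (ℤ.+ w) (ℤ.+ suc n)

ι-nonNeg : ∀ n → 0ℚ ℚ.≤ ι n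
ι-nonNeg n = ℚP.nonNegative⁻¹ (ι n) {{ℚP.normalize-nonNeg n 1}}

ι-pos : ∀ n → 0ℚ ℚ.< ι (suc n)
ι-pos n = ℚP.positive⁻¹ (ι (suc n)) {{ℚP.normalize-pos (suc n) 1}}

sub-add-cancel : ∀ p q → q - p + p ≡ q
sub-add-cancel = solve-∀ ℚ-ring

≤⇒0≤- : ∀ {p q} → p ℚ.≤ q → 0ℚ ℚ.≤ q - p
≤⇒0≤- {p} {q} p≤q = subst (ℚ._≤ q - p) (ℚP.+-inverseʳ p) (ℚP.+-monoˡ-≤ (- p) p≤q)

0≤-⇒≤ : ∀ {p q} → 0ℚ ℚ.≤ q - p → p ℚ.≤ q
0≤-⇒≤ {p} {q} 0≤q-p = subst₂ ℚ._≤_ (ℚP.+-identityˡ p) (sub-add-cancel p q) (ℚP.+-monoˡ-≤ p 0≤q-p)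

<⇒0<- : ∀ {p q} → p ℚ.< q → 0ℚ ℚ.< q - p
<⇒0<- {p} {q} p<q = subst (ℚ._< q - p) (ℚP.+-inverseʳ p) (ℚP.+-monoˡ-< (- p) p<q)

0<-⇒< : ∀ {p q} → 0ℚ ℚ.< q - p → p ℚ.< q
0<-⇒< {p} {q} 0<q-p = subst₂ ℚ._<_ (ℚP.+-identityˡ p) (sub-add-cancel p q) (ℚP.+-monoˡ-< p 0<q-p)

≡⇒-≡0 : ∀ {p q} → p ≡ q → q - p ≡ 0ℚ
≡⇒-≡0 {p} refl = ℚP.+-inverseʳ p

-≡0⇒≡ : ∀ {p q} → q - p ≡ 0ℚ → p ≡ q
-≡0⇒≡ {p} {q} q-p≡0 = trans (sym (trans (cong (_+ p) q-p≡0) (ℚP.+-identityˡ p))) (sub-add-cancel p q)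

0≤* : ∀ {p q} → 0ℚ ℚ.≤ p → 0ℚ ℚ.≤ q → 0ℚ ℚ.≤ p * q
0≤* {p} {q} 0≤p 0≤q =
  ℚP.nonNegative⁻¹ _ {{ℚP.nonNeg*nonNeg⇒nonNeg p {{ℚ.nonNegative 0≤p}} q {{ℚ.nonNegative 0≤q}}}}

*-cancelˡ-≤-pos′ : ∀ {c p q} → 0ℚ ℚ.< c → c * p ℚ.≤ c * q → p ℚ.≤ q
*-cancelˡ-≤-pos′ {c} 0<c = ℚP.*-cancelˡ-≤-pos c {{ℚ.positive 0<c}}

0≤*-cancelˡ : ∀ {c p} → 0ℚ ℚ.< c → 0ℚ ℚ.≤ c * p → 0ℚ ℚ.≤ p
0≤*-cancelˡ {c} {p} 0<c 0≤cp = *-cancelˡ-≤-pos′ 0<c (subst (ℚ._≤ c * p) (sym (ℚP.*-zeroʳ c)) 0≤cp)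

*≡0-cancelˡ : ∀ {c p} → 0ℚ ℚ.< c → c * p ≡ 0ℚ → p ≡ 0ℚ
*≡0-cancelˡ {c} 0<c cp≡0 = ℚP.≤-antisym
  (*-cancelˡ-≤-pos′ 0<c (ℚP.≤-reflexive (trans cp≡0 (sym (ℚP.*-zeroʳ c)))))
  (*-cancelˡ-≤-pos′ 0<c (ℚP.≤-reflexive (trans (ℚP.*-zeroʳ c) (sym cp≡0))))

ι-∸ : ∀ {m n} → n ≤ m → ι (m ∸ n) ≡ ι m - ι n
ι-∸ {m} {n} n≤m = begin
  ι (m ∸ n)                 ≡⟨ identity (ι (m ∸ n)) (ι n) ⟩
  ι (m ∸ n) + ι n - ι n     ≡⟨ cong (_- ι n) (ι-+ (m ∸ n) n) ⟨
  ι (m ∸ n ℕ.+ n) - ι n     ≡⟨ cong (λ k → ι k - ι n) (ℕP.m∸n+n≡m n≤m) ⟩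
  ι m - ι n                 ∎
  where
  open ≡-Reasoning
  identity : ∀ x y → x ≡ x + y - y
  identity = solve-∀ ℚ-ring

ι-mono-≤ : ∀ {m n} → m ≤ n → ι m ℚ.≤ ι n
ι-mono-≤ {m} {n} m≤n = 0≤-⇒≤ (subst (0ℚ ℚ.≤_) (ι-∸ m≤n) (ι-nonNeg (n ∸ m)))

ι-mono-< : ∀ {m n} → m < n → ι m ℚ.< ι n
ι-mono-< {m} {suc n} m<n = 0<-⇒< (subst (0ℚ ℚ.<_) (ι-∸ (ℕP.<⇒≤ m<n))
  (subst (λ k → 0ℚ ℚ.< ι k) (sym (ℕP.+-∸-assoc 1 (ℕ.s≤s⁻¹ m<n))) (ι-pos (n ∸ m))))

ι-cancel-< : ∀ {m n} → ι m ℚ.< ι n → m < n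
ι-cancel-< {m} {n} ιm<ιn with ℕP.<-≤-connex m n
... | inj₁ m<n = m<n
... | inj₂ n≤m = ⊥-elim (ℚP.<-irrefl refl (ℚP.<-≤-trans ιm<ιn (ι-mono-≤ n≤m)))

ι-injective : ∀ {m n} → ι m ≡ ι n → m ≡ n
ι-injective {m} {n} ιm≡ιn with ℕP.<-cmp m n
... | tri< m<n _ _ = ⊥-elim (ℚP.<-irrefl ιm≡ιn (ι-mono-< m<n))
... | tri≈ _ m≡n _ = m≡n
... | tri> _ _ n<m = ⊥-elim (ℚP.<-irrefl (sym ιm≡ιn) (ι-mono-< n<m))

sumℚ-sum : ∀ n (f : Fin n → ℚ) → sumℚ n f ≡ ΣQ.sum f
sumℚ-sum zero    f = refl
sumℚ-sum (suc n) f = cong (_+_ (f zero)) (sumℚ-sum n (λ j → f (suc j)))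

sumℕ-sum : ∀ n (f : Fin n → ℕ) → sumℕ n f ≡ ΣN.sum f
sumℕ-sum zero    f = refl
sumℕ-sum (suc n) f = cong (f zero ℕ.+_) (sumℕ-sum n (λ j → f (suc j)))

ι-sum : ∀ {n} (f : Fin n → ℕ) → ι (ΣN.sum f) ≡ ΣQ.sum (λ j → ι (f j))
ι-sum {zero}  f = refl
ι-sum {suc n} f = trans (ι-+ (f zero) _) (cong (_+_ (ι (f zero))) (ι-sum (λ j → f (suc j))))

prefix : ∀ {r} → (Fin r → ℚ) → ℕ → ℚ
prefix c k = ΣQ.sum (λ j → if toℕ j <ᵇ k then c j else 0ℚ)

prefix-zero : ∀ {r} (c : Fin r → ℚ) → prefix c 0 ≡ 0ℚ
prefix-zero {r} c = ΣQ.sum-replicate-zero r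

prefix-telescoping : ∀ {r} (g : ℕ → ℚ) {k} → k ≤ r →
                     prefix {r} (λ j → g (suc (toℕ j)) - g (toℕ j)) k ≡ g k - g 0
prefix-telescoping {r}     g {zero}  _         =
  trans (prefix-zero {r} (λ j → g (suc (toℕ j)) - g (toℕ j))) (sym (ℚP.+-inverseʳ (g 0)))
prefix-telescoping {suc r} g {suc k} (s≤s k≤r) = begin
  (g 1 - g 0) + prefix {r} (λ j → g (suc (suc (toℕ j))) - g (suc (toℕ j))) k
    ≡⟨ cong (_+_ (g 1 - g 0)) (prefix-telescoping (λ n → g (suc n)) k≤r) ⟩
  (g 1 - g 0) + (g (suc k) - g 1)
    ≡⟨ identity (g 0) (g 1) (g (suc k)) ⟩
  g (suc k) - g 0 ∎
  where
  open ≡-Reasoning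
  identity : ∀ x y z → (y - x) + (z - y) ≡ z - x
  identity = solve-∀ ℚ-ring

prefix-weighted : ∀ {r} (c : Fin r → ℚ) w k →
                  ΣQ.sum (λ j → c j * ι (if toℕ j <ᵇ k then w else 0)) ≡ ι w * prefix c k
prefix-weighted c w k =
  trans (ΣQ.sum-cong-≗ pointwise) (sym (ΣQ.*-distribˡ-sum (ι w) (λ j → if toℕ j <ᵇ k then c j else 0ℚ)))
  where
  pointwise : ∀ j → c j * ι (if toℕ j <ᵇ k then w else 0) ≡ ι w * (if toℕ j <ᵇ k then c j else 0ℚ)
  pointwise j with toℕ j <ᵇ k
  ... | true  = ℚP.*-comm (c j) (ι w)
  ... | false = trans (ℚP.*-zeroʳ (c j)) (sym (ℚP.*-zeroʳ (ι w)))

-- Evaluating a functional at a vertex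

partialλ partialμ : ∀ {r} → Functional r → ℕ → ℚ
partialλ f = prefix (λ j → cλ f j - d f)
partialμ f = prefix (λ j → cμ f j - d f)

sum-shift : ∀ {n} (c x : Fin n → ℚ) e →
            ΣQ.sum (λ j → (c j - e) * x j) ≡ ΣQ.sum (λ j → c j * x j) - e * ΣQ.sum x
sum-shift c x e = begin
  S
    ≡⟨ identity S (e * ΣQ.sum x) ⟩
  S + e * ΣQ.sum x - e * ΣQ.sum x
    ≡⟨ cong (λ z → S + z - e * ΣQ.sum x) (ΣQ.*-distribˡ-sum e x) ⟩
  S + ΣQ.sum (λ j → e * x j) - e * ΣQ.sum x
    ≡⟨ cong (_- e * ΣQ.sum x) (ΣQ.∑-distrib-+ (λ j → (c j - e) * x j) (λ j → e * x j)) ⟨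
  ΣQ.sum (λ j → (c j - e) * x j + e * x j) - e * ΣQ.sum x
    ≡⟨ cong (_- e * ΣQ.sum x) (ΣQ.sum-cong-≗ (λ j → shift (c j) e (x j))) ⟩
  ΣQ.sum (λ j → c j * x j) - e * ΣQ.sum x ∎
  where
  open ≡-Reasoning
  S : ℚ
  S = ΣQ.sum (λ j → (c j - e) * x j)
  identity : ∀ u v → u ≡ u + v - v
  identity = solve-∀ ℚ-ring
  shift : ∀ c e x → (c - e) * x + e * x ≡ c * x
  shift = solve-∀ ℚ-ring

ι-total : ∀ {r} (gλ gμ : Fin r → ℕ) →
          ι (sumℕ r (λ j → gλ j ℕ.+ gμ j)) ≡ ΣQ.sum (λ j → ι (gλ j)) + ΣQ.sum (λ j → ι (gμ j))
ι-total {r} gλ gμ = begin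
  ι (sumℕ r g)                                 ≡⟨ cong ι (sumℕ-sum r g) ⟩
  ι (ΣN.sum g)                                 ≡⟨ ι-sum g ⟩
  ΣQ.sum (λ j → ι (g j))                       ≡⟨ ΣQ.sum-cong-≗ (λ j → ι-+ (gλ j) (gμ j)) ⟩
  ΣQ.sum (λ j → ι (gλ j) + ι (gμ j))           ≡⟨ ΣQ.∑-distrib-+ (λ j → ι (gλ j)) (λ j → ι (gμ j)) ⟩
  ΣQ.sum (λ j → ι (gλ j)) + ΣQ.sum (λ j → ι (gμ j)) ∎
  where
  open ≡-Reasoning
  g : Fin r → ℕ
  g j = gλ j ℕ.+ gμ j

eval-scaled : ∀ {r T} (f : Functional r) (gλ gμ : Fin r → ℕ) → 0 < T →
              ι T ≡ ΣQ.sum (λ j → ι (gλ j)) + ΣQ.sum (λ j → ι (gμ j)) →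
              (sumℚ r (λ j → cλ f j * frac (gλ j) T) + sumℚ r (λ j → cμ f j * frac (gμ j) T) - d f) * ι T
                ≡ ΣQ.sum (λ j → (cλ f j - d f) * ι (gλ j)) + ΣQ.sum (λ j → (cμ f j - d f) * ι (gμ j))
eval-scaled {r} {T} f gλ gμ 0<T ιT≡ = begin
  (Aλ + Aμ - d f) * ι T
    ≡⟨ identity₁ Aλ Aμ (d f) (ι T) ⟩
  Aλ * ι T + Aμ * ι T - d f * ι T
    ≡⟨ cong₂ (λ x y → x + y - d f * ι T) (unscale (cλ f) gλ) (unscale (cμ f) gμ) ⟩
  Sλ + Sμ - d f * ι T
    ≡⟨ cong (λ t → Sλ + Sμ - d f * t) ιT≡ ⟩
  Sλ + Sμ - d f * (Nλ + Nμ)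
    ≡⟨ identity₂ Sλ Sμ (d f) Nλ Nμ ⟩
  (Sλ - d f * Nλ) + (Sμ - d f * Nμ)
    ≡⟨ cong₂ _+_ (sum-shift (cλ f) (λ j → ι (gλ j)) (d f)) (sum-shift (cμ f) (λ j → ι (gμ j)) (d f)) ⟨
  ΣQ.sum (λ j → (cλ f j - d f) * ι (gλ j)) + ΣQ.sum (λ j → (cμ f j - d f) * ι (gμ j)) ∎
  where
  open ≡-Reasoning
  Aλ Aμ Sλ Sμ Nλ Nμ : ℚ
  Aλ = sumℚ r (λ j → cλ f j * frac (gλ j) T)
  Aμ = sumℚ r (λ j → cμ f j * frac (gμ j) T)
  Sλ = ΣQ.sum (λ j → cλ f j * ι (gλ j))
  Sμ = ΣQ.sum (λ j → cμ f j * ι (gμ j))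
  Nλ = ΣQ.sum (λ j → ι (gλ j))
  Nμ = ΣQ.sum (λ j → ι (gμ j))
  identity₁ : ∀ x y e t → (x + y - e) * t ≡ x * t + y * t - e * t
  identity₁ = solve-∀ ℚ-ring
  identity₂ : ∀ x y e u v → x + y - e * (u + v) ≡ (x - e * u) + (y - e * v)
  identity₂ = solve-∀ ℚ-ring
  unscale : ∀ (c : Fin r → ℚ) g → sumℚ r (λ j → c j * frac (g j) T) * ι T ≡ ΣQ.sum (λ j → c j * ι (g j))
  unscale c g = begin
    sumℚ r (λ j → c j * frac (g j) T) * ι T       ≡⟨ cong (_* ι T) (sumℚ-sum r (λ j → c j * frac (g j) T)) ⟩
    ΣQ.sum (λ j → c j * frac (g j) T) * ι T       ≡⟨ ΣQ.*-distribʳ-sum (ι T) (λ j → c j * frac (g j) T) ⟩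
    ΣQ.sum (λ j → c j * frac (g j) T * ι T)       ≡⟨ ΣQ.sum-cong-≗ (λ j → ℚP.*-assoc (c j) (frac (g j) T) (ι T)) ⟩
    ΣQ.sum (λ j → c j * (frac (g j) T * ι T))     ≡⟨ ΣQ.sum-cong-≗ (λ j → cong (c j *_) (frac-ι (g j) 0<T)) ⟩
    ΣQ.sum (λ j → c j * ι (g j))                   ∎

eval-generator : ∀ {r} (f : Functional r) a b ℓ → 0 < genTotal r a b ℓ →
                 (eval f a b ℓ - d f) * ι (genTotal r a b ℓ)
                   ≡ ΣQ.sum (λ j → (cλ f j - d f) * ι (genλ a b ℓ (suc (toℕ j))))
                     + ΣQ.sum (λ j → (cμ f j - d f) * ι (genμ a b ℓ (suc (toℕ j))))
eval-generator {r} f a b ℓ 0<T =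
  eval-scaled f gλ gμ 0<T (ι-total gλ gμ)
  where
  gλ gμ : Fin r → ℕ
  gλ j = genλ a b ℓ (suc (toℕ j))
  gμ j = genμ a b ℓ (suc (toℕ j))

≢⇒≡ᵇ-false : ∀ {a b} → a ≢ b → (a ≡ᵇ b) ≡ false
≢⇒≡ᵇ-false {a} {b} = dec-false (a ℕ.≟ b)

≡ᵇ-refl : ∀ a → (a ≡ᵇ a) ≡ true
≡ᵇ-refl a = dec-true (a ℕ.≟ a) refl

generator-proper : ∀ {a b} ℓ → a ≢ b → genλ a b ℓ ≡ rayλ a b ℓ × genμ a b ℓ ≡ rayμ a b ℓ
generator-proper ℓ a≢b rewrite ≢⇒≡ᵇ-false a≢b = refl , refl

generator-diagonal : ∀ a ℓ → genλ a a ℓ ≡ rayλ a a 0 × genμ a a ℓ ≡ rayμ a a 0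
generator-diagonal a ℓ rewrite ≡ᵇ-refl a = refl , refl

∸-split : ∀ {a b ℓ} → ℓ ≤ b → b ≤ a → (a ∸ b) ℕ.+ (b ∸ ℓ) ≡ a ∸ ℓ
∸-split {a} {b} {ℓ} ℓ≤b b≤a =
  trans (sym (ℕP.+-∸-assoc (a ∸ b) ℓ≤b)) (cong (_∸ ℓ) (ℕP.m∸n+n≡m b≤a))

rayμ-split : ∀ {a b ℓ} → ℓ ≤ b → b ≤ a → ∀ t →
             rayμ a b ℓ (suc t) ≡ (if t <ᵇ ℓ then a ∸ b else 0) ℕ.+ (if t <ᵇ a then b ∸ ℓ else 0)
rayμ-split {a} {b} {ℓ} ℓ≤b b≤a t with t <ᵇ ℓ in t<ℓ | t <ᵇ a in t<a
... | true  | true  = sym (∸-split ℓ≤b b≤a)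
... | true  | false = ⊥-elim (subst T t<a (ℕP.<⇒<ᵇ (ℕP.<-≤-trans t<ℓ′ (ℕP.≤-trans ℓ≤b b≤a))))
  where
  t<ℓ′ : t < ℓ
  t<ℓ′ = ℕP.<ᵇ⇒< t ℓ (subst T (sym t<ℓ) _)
... | false | _     = refl

data Label (r : ℕ) : ℕ → ℕ → ℕ → Set where
  proper   : ∀ {a b ℓ} → ℓ < b → b < a → a ≤ r → Label r a b ℓ
  diagonal : ∀ {a} → 1 ≤ a → a ≤ r → Label r a a a

label : ∀ {r a b ℓ} → IsLabel r a b ℓ → Label r a b ℓ
label (inj₁ (ℓ<b , b<a , a≤r))          = proper ℓ<b b<a a≤r
label (inj₂ (refl , refl , 1≤a , a≤r)) = diagonal 1≤a a≤r

genλ-head-pos : ∀ {r a b ℓ} → Label r a b ℓ → 0 < genλ a b ℓ 1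
genλ-head-pos (proper {b = zero} () _ _)
genλ-head-pos (proper {a} {suc b} {ℓ} ℓ<b b<a _) =
  subst (λ g → 0 < g 1) (sym (proj₁ (generator-proper ℓ (ℕP.>⇒≢ b<a)))) (ℕP.m<n⇒0<n∸m (ℕP.<-trans ℓ<b b<a))
genλ-head-pos (diagonal {suc a} _ _) = subst (λ g → 0 < g 1) (sym (proj₁ (generator-diagonal (suc a) (suc a)))) (s≤s z≤n)

genTotal-pos : ∀ {r a b ℓ} → Label r a b ℓ → 0 < genTotal r a b ℓ
genTotal-pos {zero}  (proper _ b<a a≤0) = ⊥-elim (ℕP.<⇒≱ (ℕP.≤-<-trans z≤n b<a) a≤0)
genTotal-pos {zero}  (diagonal 1≤a a≤0) = ⊥-elim (ℕP.<⇒≱ 1≤a a≤0)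
genTotal-pos {suc r} {a} {b} {ℓ} L =
  ℕP.<-≤-trans (genλ-head-pos L) (ℕP.≤-trans (ℕP.m≤m+n _ (genμ a b ℓ 1)) (ℕP.m≤m+n _ _))

eval-proper : ∀ {r a b ℓ} (f : Functional r) → ℓ < b → b < a → a ≤ r →
              (eval f a b ℓ - d f) * ι (genTotal r a b ℓ)
                ≡ ι (a ∸ ℓ) * partialλ f b + (ι (a ∸ b) * partialμ f ℓ + ι (b ∸ ℓ) * partialμ f a)
eval-proper {r} {a} {b} {ℓ} f ℓ<b b<a a≤r = begin
  (eval f a b ℓ - d f) * ι (genTotal r a b ℓ)
    ≡⟨ eval-generator f a b ℓ (genTotal-pos (proper ℓ<b b<a a≤r)) ⟩
  ΣQ.sum (λ j → cλ′ j * ι (genλ a b ℓ (suc (toℕ j)))) + ΣQ.sum (λ j → cμ′ j * ι (genμ a b ℓ (suc (toℕ j))))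
    ≡⟨ cong₂ (λ gλ gμ → ΣQ.sum (λ j → cλ′ j * ι (gλ (suc (toℕ j)))) + ΣQ.sum (λ j → cμ′ j * ι (gμ (suc (toℕ j)))))
             gλ≡rayλ gμ≡rayμ ⟩
  ΣQ.sum (λ j → cλ′ j * ι (rayλ a b ℓ (suc (toℕ j)))) + ΣQ.sum (λ j → cμ′ j * ι (rayμ a b ℓ (suc (toℕ j))))
    ≡⟨ cong₂ _+_ (prefix-weighted cλ′ (a ∸ ℓ) b) μ-part ⟩
  ι (a ∸ ℓ) * partialλ f b + (ι (a ∸ b) * partialμ f ℓ + ι (b ∸ ℓ) * partialμ f a) ∎
  where
  open ≡-Reasoning
  cλ′ cμ′ : Fin r → ℚ
  cλ′ j = cλ f j - d f
  cμ′ j = cμ f j - d f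
  gλ≡rayλ : genλ a b ℓ ≡ rayλ a b ℓ
  gλ≡rayλ = proj₁ (generator-proper ℓ (ℕP.>⇒≢ b<a))
  gμ≡rayμ : genμ a b ℓ ≡ rayμ a b ℓ
  gμ≡rayμ = proj₂ (generator-proper ℓ (ℕP.>⇒≢ b<a))
  μℓ μa : ℕ → ℕ
  μℓ t = if t <ᵇ ℓ then a ∸ b else 0
  μa t = if t <ᵇ a then b ∸ ℓ else 0
  μ-part : ΣQ.sum (λ j → cμ′ j * ι (rayμ a b ℓ (suc (toℕ j))))
           ≡ ι (a ∸ b) * partialμ f ℓ + ι (b ∸ ℓ) * partialμ f a
  μ-part = begin
    ΣQ.sum (λ j → cμ′ j * ι (rayμ a b ℓ (suc (toℕ j))))
      ≡⟨ ΣQ.sum-cong-≗ (λ j → trans (cong (λ n → cμ′ j * ι n) (rayμ-split (ℕP.<⇒≤ ℓ<b) (ℕP.<⇒≤ b<a) (toℕ j)))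
                                    (trans (cong (cμ′ j *_) (ι-+ (μℓ (toℕ j)) (μa (toℕ j)))) (ℚP.*-distribˡ-+ (cμ′ j) _ _))) ⟩
    ΣQ.sum (λ j → cμ′ j * ι (μℓ (toℕ j)) + cμ′ j * ι (μa (toℕ j)))
      ≡⟨ ΣQ.∑-distrib-+ (λ j → cμ′ j * ι (μℓ (toℕ j))) (λ j → cμ′ j * ι (μa (toℕ j))) ⟩
    ΣQ.sum (λ j → cμ′ j * ι (μℓ (toℕ j))) + ΣQ.sum (λ j → cμ′ j * ι (μa (toℕ j)))
      ≡⟨ cong₂ _+_ (prefix-weighted cμ′ (a ∸ b) ℓ) (prefix-weighted cμ′ (b ∸ ℓ) a) ⟩
    ι (a ∸ b) * partialμ f ℓ + ι (b ∸ ℓ) * partialμ f a ∎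

eval-diagonal : ∀ {r a} (f : Functional r) → 1 ≤ a → a ≤ r →
                (eval f a a a - d f) * ι (genTotal r a a a) ≡ ι a * (partialλ f a + partialμ f a)
eval-diagonal {r} {a} f 1≤a a≤r = begin
  (eval f a a a - d f) * ι (genTotal r a a a)
    ≡⟨ eval-generator f a a a (genTotal-pos (diagonal 1≤a a≤r)) ⟩
  ΣQ.sum (λ j → cλ′ j * ι (genλ a a a (suc (toℕ j)))) + ΣQ.sum (λ j → cμ′ j * ι (genμ a a a (suc (toℕ j))))
    ≡⟨ cong₂ (λ gλ gμ → ΣQ.sum (λ j → cλ′ j * ι (gλ (suc (toℕ j)))) + ΣQ.sum (λ j → cμ′ j * ι (gμ (suc (toℕ j)))))
             gλ≡rayλ gμ≡rayμ ⟩
  ΣQ.sum (λ j → cλ′ j * ι (rayλ a a 0 (suc (toℕ j)))) + ΣQ.sum (λ j → cμ′ j * ι (rayμ a a 0 (suc (toℕ j))))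
    ≡⟨ cong₂ _+_ (prefix-weighted cλ′ a a) (prefix-weighted cμ′ a a) ⟩
  ι a * partialλ f a + ι a * partialμ f a
    ≡⟨ ℚP.*-distribˡ-+ (ι a) (partialλ f a) (partialμ f a) ⟨
  ι a * (partialλ f a + partialμ f a) ∎
  where
  open ≡-Reasoning
  cλ′ cμ′ : Fin r → ℚ
  cλ′ j = cλ f j - d f
  cμ′ j = cμ f j - d f
  gλ≡rayλ : genλ a a a ≡ rayλ a a 0
  gλ≡rayλ = proj₁ (generator-diagonal a a)
  gμ≡rayμ : genμ a a a ≡ rayμ a a 0
  gμ≡rayμ = proj₂ (generator-diagonal a a)

≤⇔-*≤0 : ∀ {s p q} → 0ℚ ℚ.< s → (p ℚ.≤ q ⇔ (p - q) * s ℚ.≤ 0ℚ)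
≤⇔-*≤0 {s} {p} {q} 0<s = mk⇔
  (λ p≤q → subst ((p - q) * s ℚ.≤_) (ℚP.*-zeroˡ s)
             (ℚP.*-monoʳ-≤-nonNeg s {{ℚ.nonNegative (ℚP.<⇒≤ 0<s)}}
               (subst (p - q ℚ.≤_) (ℚP.+-inverseʳ q) (ℚP.+-monoˡ-≤ (- q) p≤q))))
  (λ [p-q]s≤0 → subst₂ ℚ._≤_ (sub-add-cancel q p) (ℚP.+-identityˡ q) (ℚP.+-monoˡ-≤ q {p - q} {0ℚ}
                  (ℚP.*-cancelʳ-≤-pos {p - q} {0ℚ} s {{ℚ.positive 0<s}} (subst ((p - q) * s ℚ.≤_) (sym (ℚP.*-zeroˡ s)) [p-q]s≤0))))

≡⇔-*≡0 : ∀ {s p q} → 0ℚ ℚ.< s → (p ≡ q ⇔ (p - q) * s ≡ 0ℚ)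
≡⇔-*≡0 {s} {p} {q} 0<s = mk⇔
  (λ p≡q → trans (cong (_* s) (trans (cong (_-_ p) (sym p≡q)) (ℚP.+-inverseʳ p))) (ℚP.*-zeroˡ s))
  (λ [p-q]s≡0 → sym (-≡0⇒≡ (*≡0-cancelˡ 0<s (trans (ℚP.*-comm s (p - q)) [p-q]s≡0))))

sign-≤ : ∀ {s t e d x y} → 0ℚ ℚ.< s → 0ℚ ℚ.< t → (e - d) * s ≡ (x - y) * t → (e ℚ.≤ d ⇔ x ℚ.≤ y)
sign-≤ 0<s 0<t eq =
  ⇔.trans (≤⇔-*≤0 0<s) (⇔.trans (mk⇔ (subst (ℚ._≤ 0ℚ) eq) (subst (ℚ._≤ 0ℚ) (sym eq))) (⇔.sym (≤⇔-*≤0 0<t)))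

sign-≡ : ∀ {s t e d x y} → 0ℚ ℚ.< s → 0ℚ ℚ.< t → (e - d) * s ≡ (x - y) * t → (e ≡ d ⇔ x ≡ y)
sign-≡ 0<s 0<t eq =
  ⇔.trans (≡⇔-*≡0 0<s) (⇔.trans (mk⇔ (trans (sym eq)) (trans eq)) (⇔.sym (≡⇔-*≡0 0<t)))

-- Affine functions and chords

Affine : (ℚ → ℚ) → Set
Affine g = ∀ p q t → (q - p) * g t ≡ (q - t) * g p + (t - p) * g q

affine-sub : ∀ {g h} → Affine g → Affine h → Affine (λ t → h t - g t)
affine-sub {g} {h} G H p q t = begin
  (q - p) * (h t - g t)                                             ≡⟨ distrib (q - p) (h t) (g t) ⟩
  (q - p) * h t - (q - p) * g t                                     ≡⟨ cong₂ _-_ (H p q t) (G p q t) ⟩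
  ((q - t) * h p + (t - p) * h q) - ((q - t) * g p + (t - p) * g q) ≡⟨ regroup (q - t) (t - p) (h p) (h q) (g p) (g q) ⟩
  (q - t) * (h p - g p) + (t - p) * (h q - g q)                     ∎
  where
  open ≡-Reasoning
  distrib : ∀ c x y → c * (x - y) ≡ c * x - c * y
  distrib = solve-∀ ℚ-ring
  regroup : ∀ u v w x y z → (u * w + v * x) - (u * y + v * z) ≡ u * (w - y) + v * (x - z)
  regroup = solve-∀ ℚ-ring

affine-≤-between : ∀ {g h p q t} → Affine g → Affine h → p ℚ.< q → p ℚ.≤ t → t ℚ.≤ q →
                   g p ℚ.≤ h p → g q ℚ.≤ h q → g t ℚ.≤ h t
affine-≤-between {g} {h} {p} {q} {t} G H p<q p≤t t≤q gp≤hp gq≤hq =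
  0≤-⇒≤ (0≤*-cancelˡ (<⇒0<- p<q) (subst (0ℚ ℚ.≤_) (sym (affine-sub G H p q t))
    (ℚP.+-mono-≤ (0≤* (≤⇒0≤- t≤q) (≤⇒0≤- gp≤hp)) (0≤* (≤⇒0≤- p≤t) (≤⇒0≤- gq≤hq)))))

affine-≤-beyondʳ : ∀ {g h p q t} → Affine g → Affine h → p ℚ.< t → t ℚ.< q →
                   g p ≡ h p → g t ℚ.≤ h t → g q ℚ.≤ h q
affine-≤-beyondʳ {g} {h} {p} {q} {t} G H p<t t<q gp≡hp gt≤ht =
  0≤-⇒≤ (0≤*-cancelˡ (<⇒0<- p<t)
    (subst (0ℚ ℚ.≤_) eq (0≤* (≤⇒0≤- (ℚP.<⇒≤ (ℚP.<-trans p<t t<q))) (≤⇒0≤- gt≤ht))))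
  where
  eq : (q - p) * (h t - g t) ≡ (t - p) * (h q - g q)
  eq = trans (affine-sub G H p q t)
             (trans (cong (λ z → (q - t) * z + (t - p) * (h q - g q)) (≡⇒-≡0 gp≡hp))
                    (trans (cong (_+ (t - p) * (h q - g q)) (ℚP.*-zeroʳ (q - t))) (ℚP.+-identityˡ _)))

affine-≤-beyondˡ : ∀ {g h p q t} → Affine g → Affine h → p ℚ.< t → t ℚ.< q →
                   g q ≡ h q → g t ℚ.≤ h t → g p ℚ.≤ h p
affine-≤-beyondˡ {g} {h} {p} {q} {t} G H p<t t<q gq≡hq gt≤ht =
  0≤-⇒≤ (0≤*-cancelˡ (<⇒0<- t<q)
    (subst (0ℚ ℚ.≤_) eq (0≤* (≤⇒0≤- (ℚP.<⇒≤ (ℚP.<-trans p<t t<q))) (≤⇒0≤- gt≤ht))))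
  where
  eq : (q - p) * (h t - g t) ≡ (q - t) * (h p - g p)
  eq = trans (affine-sub G H p q t)
             (trans (cong (λ z → (q - t) * (h p - g p) + (t - p) * z) (≡⇒-≡0 gq≡hq))
                    (trans (cong (_+_ ((q - t) * (h p - g p))) (ℚP.*-zeroʳ (t - p))) (ℚP.+-identityʳ _)))

affine-≡ : ∀ {g h p q} → Affine g → Affine h → p ℚ.< q → g p ≡ h p → g q ≡ h q → ∀ t → g t ≡ h t
affine-≡ {g} {h} {p} {q} G H p<q gp≡hp gq≡hq t = -≡0⇒≡ (*≡0-cancelˡ (<⇒0<- p<q) (begin
  (q - p) * (h t - g t)                          ≡⟨ affine-sub G H p q t ⟩
  (q - t) * (h p - g p) + (t - p) * (h q - g q)  ≡⟨ cong₂ (λ x y → (q - t) * x + (t - p) * y) (≡⇒-≡0 gp≡hp) (≡⇒-≡0 gq≡hq) ⟩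
  (q - t) * 0ℚ + (t - p) * 0ℚ                    ≡⟨ identity (q - t) (t - p) ⟩
  0ℚ                                             ∎))
  where
  open ≡-Reasoning
  identity : ∀ x y → x * 0ℚ + y * 0ℚ ≡ 0ℚ
  identity = solve-∀ ℚ-ring

chord : (ℕ → ℚ) → ℕ → ℕ → ℚ → ℚ
chord φ ℓ a t = φ ℓ + (φ a - φ ℓ) * frac 1 (a ∸ ℓ) * (t - ι ℓ)

chord-affine : ∀ φ ℓ a → Affine (chord φ ℓ a)
chord-affine φ ℓ a p q t = identity (φ ℓ) ((φ a - φ ℓ) * frac 1 (a ∸ ℓ)) (ι ℓ) p q t
  where
  identity : ∀ y s l p q t → (q - p) * (y + s * (t - l)) ≡ (q - t) * (y + s * (p - l)) + (t - p) * (y + s * (q - l))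
  identity = solve-∀ ℚ-ring

chord-left : ∀ φ ℓ a → chord φ ℓ a (ι ℓ) ≡ φ ℓ
chord-left φ ℓ a = identity (φ ℓ) ((φ a - φ ℓ) * frac 1 (a ∸ ℓ)) (ι ℓ)
  where
  identity : ∀ y s l → y + s * (l - l) ≡ y
  identity = solve-∀ ℚ-ring

chord-right : ∀ φ {ℓ a} → ℓ < a → chord φ ℓ a (ι a) ≡ φ a
chord-right φ {ℓ} {a} ℓ<a = begin
  φ ℓ + (φ a - φ ℓ) * frac 1 (a ∸ ℓ) * (ι a - ι ℓ)
    ≡⟨ cong (_+_ (φ ℓ)) (ℚP.*-assoc (φ a - φ ℓ) (frac 1 (a ∸ ℓ)) (ι a - ι ℓ)) ⟩
  φ ℓ + (φ a - φ ℓ) * (frac 1 (a ∸ ℓ) * (ι a - ι ℓ))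
    ≡⟨ cong (λ z → φ ℓ + (φ a - φ ℓ) * (frac 1 (a ∸ ℓ) * z)) (ι-∸ (ℕP.<⇒≤ ℓ<a)) ⟨
  φ ℓ + (φ a - φ ℓ) * (frac 1 (a ∸ ℓ) * ι (a ∸ ℓ))
    ≡⟨ cong (λ z → φ ℓ + (φ a - φ ℓ) * z) (frac-ι 1 (ℕP.m<n⇒0<n∸m ℓ<a)) ⟩
  φ ℓ + (φ a - φ ℓ) * 1ℚ
    ≡⟨ identity (φ ℓ) (φ a) ⟩
  φ a ∎
  where
  open ≡-Reasoning
  identity : ∀ x y → x + (y - x) * 1ℚ ≡ y
  identity = solve-∀ ℚ-ring

chord-interpolates : ∀ φ {ℓ a} → ℓ < a → ∀ t → (ι a - ι ℓ) * chord φ ℓ a t ≡ (ι a - t) * φ ℓ + (t - ι ℓ) * φ a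
chord-interpolates φ {ℓ} {a} ℓ<a t =
  trans (chord-affine φ ℓ a (ι ℓ) (ι a) t)
        (cong₂ (λ x y → (ι a - t) * x + (t - ι ℓ) * y) (chord-left φ ℓ a) (chord-right φ ℓ<a))

-- Functions lying below the chords of another

module _ {m : ℕ} (as bs ls : Fin m → ℕ) where

  InB : ℕ → Set
  InB q = ∃[ i ] q ≡ bs i

  InE : ℕ → Set
  InE q = ∃[ i ] (q ≡ ls i ⊎ q ≡ as i)

  InU : ℕ → Set
  InU k = ∃[ i ] (ls i < k × k < as i)

  InteriorCover : ℕ → ℕ → Set
  InteriorCover ℓ a = ∀ k → ℓ < k → k < a → InU k

module Envelope (r : ℕ) (ψ φ : ℕ → ℚ)
  (ψ≤chord : ∀ {ℓ b a} → ℓ < b → b < a → a ≤ r → ψ b ℚ.≤ chord φ ℓ a (ι b))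
  (ψ≤φ : ∀ {a} → 1 ≤ a → a ≤ r → ψ a ℚ.≤ φ a) where

  record Tight (ℓ b a : ℕ) : Set where
    field
      ℓ<b     : ℓ < b
      b<a     : b < a
      a≤r     : a ≤ r
      touches : ψ b ≡ chord φ ℓ a (ι b)

    ℓ<a : ℓ < a
    ℓ<a = ℕP.<-trans ℓ<b b<a

  open Tight

  chord-below-φ : ∀ {ℓ b a k} → Tight ℓ b a → k ≤ r → chord φ ℓ a (ι k) ℚ.≤ φ k
  chord-below-φ {ℓ} {b} {a} {k} t k≤r with ℕP.<-cmp k b
  ... | tri< k<b _ _ = subst (chord φ ℓ a (ι k) ℚ.≤_) (chord-left φ k a)
        (affine-≤-beyondˡ (chord-affine φ ℓ a) (chord-affine φ k a) (ι-mono-< k<b) (ι-mono-< (b<a t))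
          (trans (chord-right φ (ℓ<a t)) (sym (chord-right φ (ℕP.<-trans k<b (b<a t)))))
          (subst (ℚ._≤ chord φ k a (ι b)) (touches t) (ψ≤chord k<b (b<a t) (a≤r t))))
  ... | tri≈ _ refl _ = subst (ℚ._≤ φ b) (touches t) (ψ≤φ (ℕP.≤-<-trans z≤n (ℓ<b t)) k≤r)
  ... | tri> _ _ b<k = subst (chord φ ℓ a (ι k) ℚ.≤_) (chord-right φ (ℕP.<-trans (ℓ<b t) b<k))
        (affine-≤-beyondʳ (chord-affine φ ℓ a) (chord-affine φ ℓ k) (ι-mono-< (ℓ<b t)) (ι-mono-< b<k)
          (trans (chord-left φ ℓ a) (sym (chord-left φ ℓ k)))
          (subst (ℚ._≤ chord φ ℓ k (ι b)) (touches t) (ψ≤chord (ℓ<b t) b<k k≤r)))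

  chord-≤-chord : ∀ {ℓ₁ b₁ a₁ ℓ₂ b₂ a₂ k} → Tight ℓ₁ b₁ a₁ → Tight ℓ₂ b₂ a₂ → ℓ₂ ≤ k → k ≤ a₂ →
                  chord φ ℓ₁ a₁ (ι k) ℚ.≤ chord φ ℓ₂ a₂ (ι k)
  chord-≤-chord {ℓ₁} {b₁} {a₁} {ℓ₂} {b₂} {a₂} t₁ t₂ ℓ₂≤k k≤a₂ =
    affine-≤-between (chord-affine φ ℓ₁ a₁) (chord-affine φ ℓ₂ a₂)
      (ι-mono-< (ℓ<a t₂)) (ι-mono-≤ ℓ₂≤k) (ι-mono-≤ k≤a₂)
      (subst (chord φ ℓ₁ a₁ (ι ℓ₂) ℚ.≤_) (sym (chord-left φ ℓ₂ a₂))
             (chord-below-φ t₁ (ℕP.≤-trans (ℕP.<⇒≤ (ℓ<a t₂)) (a≤r t₂))))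
      (subst (chord φ ℓ₁ a₁ (ι a₂) ℚ.≤_) (sym (chord-right φ (ℓ<a t₂))) (chord-below-φ t₁ (a≤r t₂)))

  chords-agree : ∀ {ℓ₁ b₁ a₁ ℓ₂ b₂ a₂ k} → Tight ℓ₁ b₁ a₁ → Tight ℓ₂ b₂ a₂ →
                 ℓ₁ ≤ k → ℓ₂ ≤ k → suc k ≤ a₁ → suc k ≤ a₂ → ∀ t → chord φ ℓ₁ a₁ t ≡ chord φ ℓ₂ a₂ t
  chords-agree {k = k} t₁ t₂ ℓ₁≤k ℓ₂≤k k<a₁ k<a₂ =
    affine-≡ (chord-affine φ _ _) (chord-affine φ _ _) (ι-mono-< (ℕP.n<1+n k))
      (ℚP.≤-antisym (chord-≤-chord t₁ t₂ ℓ₂≤k (ℕP.<⇒≤ k<a₂)) (chord-≤-chord t₂ t₁ ℓ₁≤k (ℕP.<⇒≤ k<a₁)))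
      (ℚP.≤-antisym (chord-≤-chord t₁ t₂ (ℕP.m≤n⇒m≤1+n ℓ₂≤k) k<a₂)
                    (chord-≤-chord t₂ t₁ (ℕP.m≤n⇒m≤1+n ℓ₁≤k) k<a₁))

  data Contact (k : ℕ) : Set where
    endpoint : ∀ {ℓ b a} → Tight ℓ b a → k ≡ ℓ ⊎ k ≡ a → Contact k
    touching : ψ k ≡ φ k → Contact k

  φ≤chord : ∀ {k ℓ b a} → Contact k → Tight ℓ b a → ℓ ≤ k → k ≤ a → φ k ℚ.≤ chord φ ℓ a (ι k)
  φ≤chord (endpoint t′ (inj₁ refl)) t ℓ≤k k≤a = subst (ℚ._≤ _) (chord-left φ _ _) (chord-≤-chord t′ t ℓ≤k k≤a)
  φ≤chord (endpoint t′ (inj₂ refl)) t ℓ≤k k≤a = subst (ℚ._≤ _) (chord-right φ (ℓ<a t′)) (chord-≤-chord t′ t ℓ≤k k≤a)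
  φ≤chord (touching ψk≡φk) t ℓ≤k k≤a with ℕP.m≤n⇒m<n∨m≡n ℓ≤k | ℕP.m≤n⇒m<n∨m≡n k≤a
  ... | inj₂ refl | _         = ℚP.≤-reflexive (sym (chord-left φ _ _))
  ... | inj₁ _    | inj₂ refl = ℚP.≤-reflexive (sym (chord-right φ (ℓ<a t)))
  ... | inj₁ ℓ<k  | inj₁ k<a  = subst (ℚ._≤ _) ψk≡φk (ψ≤chord ℓ<k k<a (a≤r t))

  data TightLabel : ℕ → ℕ → ℕ → Set where
    proper   : ∀ {a b ℓ} → Tight ℓ b a → TightLabel a b ℓ
    diagonal : ∀ {a} → 1 ≤ a → a ≤ r → ψ a ≡ φ a → TightLabel a a a

  tight-chord : ∀ {a b ℓ} → TightLabel a b ℓ → ℓ < a → Tight ℓ b a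
  tight-chord (proper t)       _   = t
  tight-chord (diagonal _ _ _) ℓ<a = ⊥-elim (ℕP.<-irrefl refl ℓ<a)

  contact : ∀ {a b ℓ k} → TightLabel a b ℓ → k ≡ ℓ ⊎ k ≡ a → Contact k
  contact (proper t)             k≡ℓ∨a       = endpoint t k≡ℓ∨a
  contact (diagonal _ _ ψa≡φa)   (inj₁ refl) = touching ψa≡φa
  contact (diagonal _ _ ψa≡φa)   (inj₂ refl) = touching ψa≡φa

  chord≤ψ : ∀ {a b ℓ ℓ′ b′ a′} → TightLabel a b ℓ → Tight ℓ′ b′ a′ → chord φ ℓ′ a′ (ι b) ℚ.≤ ψ b
  chord≤ψ (proper t)             t′ =
    subst (_ ℚ.≤_) (sym (touches t)) (chord-≤-chord t′ t (ℕP.<⇒≤ (ℓ<b t)) (ℕP.<⇒≤ (b<a t)))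
  chord≤ψ (diagonal _ a≤r ψa≡φa) t′ = subst (_ ℚ.≤_) (sym ψa≡φa) (chord-below-φ t′ a≤r)

  φ≤ψ : ∀ {a b ℓ} → TightLabel a b ℓ → Contact b → φ b ℚ.≤ ψ b
  φ≤ψ {b = b} (proper t) c = subst (φ b ℚ.≤_) (sym (touches t)) (φ≤chord c t (ℕP.<⇒≤ (ℓ<b t)) (ℕP.<⇒≤ (b<a t)))
  φ≤ψ (diagonal _ _ ψa≡φa) _ = ℚP.≤-reflexive (sym ψa≡φa)

  module _ {m} {as bs ls : Fin m → ℕ} (tight : ∀ i → TightLabel (as i) (bs i) (ls i)) where

    chordᵢ : Fin m → ℚ → ℚ
    chordᵢ i = chord φ (ls i) (as i)

    tightᵢ : ∀ {i} → ls i < as i → Tight (ls i) (bs i) (as i)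
    tightᵢ {i} = tight-chord (tight i)

    contactᵢ : ∀ {k} → InE as bs ls k → Contact k
    contactᵢ (i , k≡ℓᵢ∨aᵢ) = contact (tight i) k≡ℓᵢ∨aᵢ

    cover-chords-agree : ∀ {ℓ a i₀} → InteriorCover as bs ls ℓ a → ls i₀ < suc ℓ → suc ℓ < as i₀ →
                         ∀ {k i} → ℓ < k → k < a → ls i < k → k < as i → ∀ t → chordᵢ i t ≡ chordᵢ i₀ t
    cover-chords-agree cover l₀ h₀ {suc k} (s≤s ℓ≤k) sk<a lᵢ hᵢ with ℕP.m≤n⇒m<n∨m≡n ℓ≤k
    ... | inj₂ refl = chords-agree (tightᵢ (ℕP.<-trans lᵢ hᵢ)) (tightᵢ (ℕP.<-trans l₀ h₀))
                        (ℕ.s≤s⁻¹ lᵢ) (ℕ.s≤s⁻¹ l₀) (ℕP.<⇒≤ hᵢ) (ℕP.<⇒≤ h₀)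
    ... | inj₁ ℓ<k with cover k ℓ<k (ℕP.<-trans (ℕP.n<1+n k) sk<a)
    ...   | j , lⱼ , hⱼ = λ t →
            trans (chords-agree (tightᵢ (ℕP.<-trans lᵢ hᵢ)) (tightᵢ (ℕP.<-trans lⱼ hⱼ))
                                (ℕ.s≤s⁻¹ lᵢ) (ℕP.<⇒≤ lⱼ) (ℕP.<⇒≤ hᵢ) hⱼ t)
                  (cover-chords-agree cover l₀ h₀ ℓ<k (ℕP.<-trans (ℕP.n<1+n k) sk<a) lⱼ hⱼ t)

    proper-tight : ∀ {ℓ b a} → ℓ < b → b < a → a ≤ r →
                   InB as bs ls b → InE as bs ls ℓ → InE as bs ls a → InteriorCover as bs ls ℓ a → Tight ℓ b a
    proper-tight {ℓ} {b} {suc a′} ℓ<b b<a a≤r (j , b≡bⱼ) ℓ∈E a∈E cover = record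
      { ℓ<b = ℓ<b ; b<a = b<a ; a≤r = a≤r
      ; touches = ℚP.≤-antisym (ψ≤chord ℓ<b b<a a≤r) (subst (ℚ._≤ ψ b) (sym (chord≡chord₀ (ι b))) chord₀≤ψ) }
      where
      a : ℕ
      a = suc a′
      ℓ<a′ : ℓ < a′
      ℓ<a′ = ℕP.<-≤-trans ℓ<b (ℕ.s≤s⁻¹ b<a)
      i₀-cover : InU as bs ls (suc ℓ)
      i₀-cover = cover (suc ℓ) (ℕP.n<1+n ℓ) (ℕP.≤-<-trans ℓ<b b<a)
      i₀ : Fin m
      i₀ = proj₁ i₀-cover
      l₀ : ls i₀ < suc ℓ
      l₀ = proj₁ (proj₂ i₀-cover)
      h₀ : suc ℓ < as i₀
      h₀ = proj₂ (proj₂ i₀-cover)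
      t₀ : Tight (ls i₀) (bs i₀) (as i₀)
      t₀ = tightᵢ (ℕP.<-trans l₀ h₀)
      i₁-cover : InU as bs ls a′
      i₁-cover = cover a′ ℓ<a′ (ℕP.n<1+n a′)
      i₁ : Fin m
      i₁ = proj₁ i₁-cover
      l₁ : ls i₁ < a′
      l₁ = proj₁ (proj₂ i₁-cover)
      h₁ : a′ < as i₁
      h₁ = proj₂ (proj₂ i₁-cover)
      φℓ≡ : φ ℓ ≡ chordᵢ i₀ (ι ℓ)
      φℓ≡ = ℚP.≤-antisym (φ≤chord (contactᵢ ℓ∈E) t₀ (ℕ.s≤s⁻¹ l₀) (ℕP.<⇒≤ (ℕP.<-trans (ℕP.n<1+n ℓ) h₀)))
                         (chord-below-φ t₀ (ℕP.≤-trans (ℕP.<⇒≤ (ℕP.<-trans ℓ<b b<a)) a≤r))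
      φa≡ : φ a ≡ chordᵢ i₀ (ι a)
      φa≡ = ℚP.≤-antisym
        (subst (φ a ℚ.≤_) (cover-chords-agree cover l₀ h₀ ℓ<a′ (ℕP.n<1+n a′) l₁ h₁ (ι a))
               (φ≤chord (contactᵢ a∈E) (tightᵢ (ℕP.<-trans l₁ h₁)) (ℕP.≤-trans (ℕP.<⇒≤ l₁) (ℕP.n≤1+n a′)) h₁))
        (chord-below-φ t₀ a≤r)
      chord≡chord₀ : ∀ t → chord φ ℓ a t ≡ chordᵢ i₀ t
      chord≡chord₀ = affine-≡ (chord-affine φ ℓ a) (chord-affine φ (ls i₀) (as i₀)) (ι-mono-< (ℕP.<-trans ℓ<b b<a))
                       (trans (chord-left φ ℓ a) φℓ≡) (trans (chord-right φ (ℕP.<-trans ℓ<b b<a)) φa≡)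
      chord₀≤ψ : chordᵢ i₀ (ι b) ℚ.≤ ψ b
      chord₀≤ψ = subst (λ z → chordᵢ i₀ (ι z) ℚ.≤ ψ z) (sym b≡bⱼ) (chord≤ψ (tight j) t₀)

    diagonal-tight : ∀ {a} → 1 ≤ a → a ≤ r → InB as bs ls a → InE as bs ls a → ψ a ≡ φ a
    diagonal-tight 1≤a a≤r (j , a≡bⱼ) a∈E = ℚP.≤-antisym (ψ≤φ 1≤a a≤r)
      (subst (λ z → φ z ℚ.≤ ψ z) (sym a≡bⱼ) (φ≤ψ (tight j) (contactᵢ (subst (InE as bs ls) a≡bⱼ a∈E))))

-- The concavity defect of k ⊓ _

∸-interpolation : ∀ {a b ℓ} → ℓ ≤ b → b ≤ a → (a ∸ ℓ) ℕ.* b ≡ (a ∸ b) ℕ.* ℓ ℕ.+ (b ∸ ℓ) ℕ.* a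
∸-interpolation {a} {b} {ℓ} ℓ≤b b≤a rewrite sym (∸-split ℓ≤b b≤a) =
  subst₂ (λ B A → (v ℕ.+ u) ℕ.* B ≡ v ℕ.* ℓ ℕ.+ u ℕ.* A) ℓ+u≡b ℓ+u+v≡a (identity v u ℓ)
  where
  u v : ℕ
  u = b ∸ ℓ
  v = a ∸ b
  ℓ+u≡b : ℓ ℕ.+ u ≡ b
  ℓ+u≡b = ℕP.m+[n∸m]≡n ℓ≤b
  ℓ+u+v≡a : ℓ ℕ.+ u ℕ.+ v ≡ a
  ℓ+u+v≡a = trans (cong (ℕ._+ v) ℓ+u≡b) (ℕP.m+[n∸m]≡n b≤a)
  identity : ∀ v u ℓ → (v ℕ.+ u) ℕ.* (ℓ ℕ.+ u) ≡ v ℕ.* ℓ ℕ.+ u ℕ.* (ℓ ℕ.+ u ℕ.+ v)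
  identity = ℕ-Solver.solve-∀

record Tent (ℓ b a k : ℕ) : Set where
  field
    excess     : ℕ
    split      : (a ∸ ℓ) ℕ.* (k ⊓ b) ≡ excess ℕ.+ ((a ∸ b) ℕ.* (k ⊓ ℓ) ℕ.+ (b ∸ ℓ) ℕ.* (k ⊓ a))
    excess-pos : ℓ < k → k < a → 0 < excess
    excess-0   : k ≤ ℓ ⊎ a ≤ k → excess ≡ 0

module _ {ℓ b a : ℕ} (ℓ<b : ℓ < b) (b<a : b < a) where

  tent-left : ∀ {k} → k ≤ ℓ → Tent ℓ b a k
  tent-left {k} k≤ℓ = record
    { excess = 0 ; split = split ; excess-pos = λ ℓ<k _ → ⊥-elim (ℕP.<⇒≱ ℓ<k k≤ℓ) ; excess-0 = λ _ → refl }
    where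
    split : (a ∸ ℓ) ℕ.* (k ⊓ b) ≡ 0 ℕ.+ ((a ∸ b) ℕ.* (k ⊓ ℓ) ℕ.+ (b ∸ ℓ) ℕ.* (k ⊓ a))
    split rewrite ℕP.m≤n⇒m⊓n≡m (ℕP.≤-trans k≤ℓ (ℕP.<⇒≤ ℓ<b)) | ℕP.m≤n⇒m⊓n≡m k≤ℓ
                | ℕP.m≤n⇒m⊓n≡m (ℕP.≤-trans k≤ℓ (ℕP.<⇒≤ (ℕP.<-trans ℓ<b b<a)))
                | sym (∸-split (ℕP.<⇒≤ ℓ<b) (ℕP.<⇒≤ b<a)) = ℕP.*-distribʳ-+ k (a ∸ b) (b ∸ ℓ)

  tent-rising : ∀ {k} → ℓ < k → k ≤ b → Tent ℓ b a k
  tent-rising {k} ℓ<k k≤b = record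
    { excess = (a ∸ b) ℕ.* (k ∸ ℓ) ; split = split
    ; excess-pos = λ _ _ → ℕP.*-mono-< (ℕP.m<n⇒0<n∸m b<a) (ℕP.m<n⇒0<n∸m ℓ<k)
    ; excess-0 = λ { (inj₁ k≤ℓ) → ⊥-elim (ℕP.<⇒≱ ℓ<k k≤ℓ)
                   ; (inj₂ a≤k) → ⊥-elim (ℕP.<⇒≱ (ℕP.≤-<-trans k≤b b<a) a≤k) } }
    where
    identity : ∀ Q R ℓ s → (Q ℕ.+ R) ℕ.* (ℓ ℕ.+ s) ≡ Q ℕ.* s ℕ.+ (Q ℕ.* ℓ ℕ.+ R ℕ.* (ℓ ℕ.+ s))
    identity = ℕ-Solver.solve-∀
    split : (a ∸ ℓ) ℕ.* (k ⊓ b) ≡ (a ∸ b) ℕ.* (k ∸ ℓ) ℕ.+ ((a ∸ b) ℕ.* (k ⊓ ℓ) ℕ.+ (b ∸ ℓ) ℕ.* (k ⊓ a))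
    split rewrite ℕP.m≤n⇒m⊓n≡m k≤b | ℕP.m≥n⇒m⊓n≡n (ℕP.<⇒≤ ℓ<k)
                | ℕP.m≤n⇒m⊓n≡m (ℕP.≤-trans k≤b (ℕP.<⇒≤ b<a))
                | sym (∸-split (ℕP.<⇒≤ ℓ<b) (ℕP.<⇒≤ b<a)) =
      subst (λ x → (a ∸ b ℕ.+ (b ∸ ℓ)) ℕ.* x ≡ (a ∸ b) ℕ.* (k ∸ ℓ) ℕ.+ ((a ∸ b) ℕ.* ℓ ℕ.+ (b ∸ ℓ) ℕ.* x))
            (ℕP.m+[n∸m]≡n (ℕP.<⇒≤ ℓ<k)) (identity (a ∸ b) (b ∸ ℓ) ℓ (k ∸ ℓ))

  tent-falling : ∀ {k} → b < k → k ≤ a → Tent ℓ b a k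
  tent-falling {k} b<k k≤a = record
    { excess = (b ∸ ℓ) ℕ.* (a ∸ k) ; split = split
    ; excess-pos = λ _ k<a → ℕP.*-mono-< (ℕP.m<n⇒0<n∸m ℓ<b) (ℕP.m<n⇒0<n∸m k<a)
    ; excess-0 = λ { (inj₁ k≤ℓ) → ⊥-elim (ℕP.<⇒≱ (ℕP.<-trans ℓ<b b<k) k≤ℓ)
                   ; (inj₂ a≤k) → trans (cong (λ x → (b ∸ ℓ) ℕ.* (a ∸ x)) (ℕP.≤-antisym k≤a a≤k))
                                        (trans (cong ((b ∸ ℓ) ℕ.*_) (ℕP.n∸n≡0 a)) (ℕP.*-zeroʳ (b ∸ ℓ))) } }
    where
    identity : ∀ Q R ℓ k w → Q ℕ.* ℓ ℕ.+ R ℕ.* (k ℕ.+ w) ≡ R ℕ.* w ℕ.+ (Q ℕ.* ℓ ℕ.+ R ℕ.* k)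
    identity = ℕ-Solver.solve-∀
    split : (a ∸ ℓ) ℕ.* (k ⊓ b) ≡ (b ∸ ℓ) ℕ.* (a ∸ k) ℕ.+ ((a ∸ b) ℕ.* (k ⊓ ℓ) ℕ.+ (b ∸ ℓ) ℕ.* (k ⊓ a))
    split rewrite ℕP.m≥n⇒m⊓n≡n (ℕP.<⇒≤ b<k) | ℕP.m≥n⇒m⊓n≡n (ℕP.<⇒≤ (ℕP.<-trans ℓ<b b<k))
                | ℕP.m≤n⇒m⊓n≡m k≤a =
      trans (∸-interpolation (ℕP.<⇒≤ ℓ<b) (ℕP.<⇒≤ b<a))
            (subst (λ x → (a ∸ b) ℕ.* ℓ ℕ.+ (b ∸ ℓ) ℕ.* x ≡ (b ∸ ℓ) ℕ.* (a ∸ k) ℕ.+ ((a ∸ b) ℕ.* ℓ ℕ.+ (b ∸ ℓ) ℕ.* k))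
                   (ℕP.m+[n∸m]≡n k≤a) (identity (a ∸ b) (b ∸ ℓ) ℓ k (a ∸ k)))

  tent-right : ∀ {k} → a < k → Tent ℓ b a k
  tent-right {k} a<k = record
    { excess = 0 ; split = split ; excess-pos = λ _ k<a → ⊥-elim (ℕP.<-asym k<a a<k) ; excess-0 = λ _ → refl }
    where
    split : (a ∸ ℓ) ℕ.* (k ⊓ b) ≡ 0 ℕ.+ ((a ∸ b) ℕ.* (k ⊓ ℓ) ℕ.+ (b ∸ ℓ) ℕ.* (k ⊓ a))
    split rewrite ℕP.m≥n⇒m⊓n≡n (ℕP.<⇒≤ (ℕP.<-trans b<a a<k))
                | ℕP.m≥n⇒m⊓n≡n (ℕP.<⇒≤ (ℕP.<-trans (ℕP.<-trans ℓ<b b<a) a<k))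
                | ℕP.m≥n⇒m⊓n≡n (ℕP.<⇒≤ a<k) =
      ∸-interpolation (ℕP.<⇒≤ ℓ<b) (ℕP.<⇒≤ b<a)

tent : ∀ {ℓ b a} → ℓ < b → b < a → ∀ k → Tent ℓ b a k
tent {ℓ} {b} {a} ℓ<b b<a k with ℕP.≤-<-connex k ℓ | ℕP.≤-<-connex k b | ℕP.≤-<-connex k a
... | inj₁ k≤ℓ | _         | _         = tent-left ℓ<b b<a k≤ℓ
... | inj₂ ℓ<k | inj₁ k≤b  | _         = tent-rising ℓ<b b<a ℓ<k k≤b
... | inj₂ _   | inj₂ b<k  | inj₁ k≤a  = tent-falling ℓ<b b<a b<k k≤a
... | inj₂ _   | inj₂ _    | inj₂ a<k  = tent-right ℓ<b b<a a<k

-- Condition (3) versus covers by integers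

module _ {m : ℕ} (as ls : Fin m → ℕ) where

  Covered : ℕ → ℕ → Set
  Covered ℓ a = ∀ (x : ℚ) → ι ℓ ℚ.< x → x ℚ.< ι a → ∃[ i ] (ι (ls i) ℚ.< x × x ℚ.< ι (as i))

NearInteger : ℕ → ℕ → ℚ → Set
NearInteger ℓ a x = ∃[ k ] (ℓ < k × k < a × ι (ℕ.pred k) ℚ.< x × x ℚ.< ι (suc k))

near-integer : ∀ {ℓ x} a → suc ℓ < a → ι ℓ ℚ.< x → x ℚ.< ι a → NearInteger ℓ a x
near-integer (suc zero)    (s≤s ())
near-integer {ℓ} {x} (suc (suc a)) (s≤s (s≤s ℓ≤a)) ℓ<x x<a =
  [ (λ a<x → suc a , s≤s ℓ≤a , ℕP.n<1+n (suc a) , a<x , x<a)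
  , (λ a≮x → widen (near-integer (suc a) (s≤s (ι-cancel-< (ℚP.<-≤-trans ℓ<x (ℚP.≮⇒≥ a≮x)))) ℓ<x
                                 (ℚP.≤-<-trans (ℚP.≮⇒≥ a≮x) (ι-mono-< (ℕP.n<1+n a)))))
  ]′ (toSum (ι a ℚP.<? x))
  where
  widen : ∀ {ℓ x} → NearInteger ℓ (suc a) x → NearInteger ℓ (suc (suc a)) x
  widen (k , ℓ<k , k<a , k-1<x , x<k+1) = k , ℓ<k , ℕP.<-trans k<a (ℕP.n<1+n (suc a)) , k-1<x , x<k+1

covered⇒cover : ∀ {m} {as bs ls : Fin m → ℕ} {ℓ a} → Covered as ls ℓ a → InteriorCover as bs ls ℓ a
covered⇒cover covered k ℓ<k k<a with covered (ι k) (ι-mono-< ℓ<k) (ι-mono-< k<a)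
... | i , ℓᵢ<k , k<aᵢ = i , ι-cancel-< ℓᵢ<k , ι-cancel-< k<aᵢ

cover⇒covered : ∀ {m} {as bs ls : Fin m → ℕ} {ℓ a} → suc ℓ < a → InteriorCover as bs ls ℓ a → Covered as ls ℓ a
cover⇒covered {a = a} sℓ<a cover x ℓ<x x<a with near-integer a sℓ<a ℓ<x x<a
... | k , ℓ<k , k<a , k-1<x , x<k+1 with cover k ℓ<k k<a
...   | i , ℓᵢ<k , k<aᵢ = i , ℚP.≤-<-trans (ι-mono-≤ (ℕP.<⇒≤pred ℓᵢ<k)) k-1<x , ℚP.<-≤-trans x<k+1 (ι-mono-≤ k<aᵢ)

-- A functional whose face is cut out by the conditions

absent : ∀ {A : Set} → Dec A → ℕ
absent (yes _) = 0
absent (no  _) = 1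

-- Vanishes at 0 whatever P says: X and Y below are prefix sums, so they must vanish at 0.
outside : ∀ {P : ℕ → Set} → (∀ q → Dec (P q)) → ℕ → ℕ
outside P? zero    = 0
outside P? (suc q) = absent (P? (suc q))

outside-∈ : ∀ {P : ℕ → Set} (P? : ∀ q → Dec (P q)) {q} → P q → outside P? q ≡ 0
outside-∈ P? {zero}  _ = refl
outside-∈ P? {suc q} p with P? (suc q)
... | yes _ = refl
... | no ¬p = ⊥-elim (¬p p)

outside-≡0⇒∈ : ∀ {P : ℕ → Set} (P? : ∀ q → Dec (P q)) {q} → 1 ≤ q → outside P? q ≡ 0 → P q
outside-≡0⇒∈ P? {suc q} _ absent≡0 with P? (suc q)
... | yes p = p
... | no  _ = ⊥-elim (ℕP.1+n≢0 absent≡0)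

sum≡0⇒all≡0 : ∀ {n} (f : Fin n → ℕ) → ΣN.sum f ≡ 0 → ∀ j → f j ≡ 0
sum≡0⇒all≡0 f Σf≡0 zero    = ℕP.m+n≡0⇒m≡0 (f zero) Σf≡0
sum≡0⇒all≡0 f Σf≡0 (suc j) = sum≡0⇒all≡0 (λ j → f (suc j)) (ℕP.m+n≡0⇒n≡0 (f zero) Σf≡0) j

all≡0⇒sum≡0 : ∀ {n} (f : Fin n → ℕ) → (∀ j → f j ≡ 0) → ΣN.sum f ≡ 0
all≡0⇒sum≡0 {n} f f≡0 = trans (ΣN.sum-cong-≗ f≡0) (ΣN.sum-replicate-zero n)

*≡0⇒≡0 : ∀ {p q} → 0 < p → p ℕ.* q ≡ 0 → q ≡ 0
*≡0⇒≡0 {p} 0<p pq≡0 with ℕP.m*n≡0⇒m≡0∨n≡0 p pq≡0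
... | inj₁ refl = ⊥-elim (ℕP.<-irrefl refl 0<p)
... | inj₂ q≡0  = q≡0

module Witness (r : ℕ) {m} (as bs ls : Fin m → ℕ) where

  InB? : ∀ q → Dec (InB as bs ls q)
  InB? q = any? (λ i → q ℕ.≟ bs i)

  InE? : ∀ q → Dec (InE as bs ls q)
  InE? q = any? (λ i → (q ℕ.≟ ls i) ⊎-dec (q ℕ.≟ as i))

  InU? : ∀ k → Dec (InU as bs ls k)
  InU? k = any? (λ i → (ls i ℕ.<? k) ×-dec (k ℕ.<? as i))

  kinks : ℕ → ℕ
  kinks q = ΣN.sum (λ (j : Fin r) → outside InU? (toℕ j) ℕ.* (toℕ j ⊓ q))

  X Y : ℕ → ℚ
  X q = - ι (outside InB? q ℕ.+ kinks q)
  Y q = ι (kinks q) - ι (outside InE? q)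

  witness : Functional r
  witness = record
    { cλ = λ j → X (suc (toℕ j)) - X (toℕ j)
    ; cμ = λ j → Y (suc (toℕ j)) - Y (toℕ j)
    ; d  = 0ℚ
    }

  kinks-0 : kinks 0 ≡ 0
  kinks-0 = all≡0⇒sum≡0 {r} (λ j → outside InU? (toℕ j) ℕ.* (toℕ j ⊓ 0))
    (λ j → trans (cong (outside InU? (toℕ j) ℕ.*_) (ℕP.⊓-zeroʳ (toℕ j))) (ℕP.*-zeroʳ (outside InU? (toℕ j))))

  prefix-witness : ∀ (g : ℕ → ℚ) → g 0 ≡ 0ℚ → ∀ {k} → k ≤ r →
                   prefix {r} (λ j → (g (suc (toℕ j)) - g (toℕ j)) - 0ℚ) k ≡ g k
  prefix-witness g g0≡0 {k} k≤r = begin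
    prefix {r} (λ j → Δ j - 0ℚ) k
      ≡⟨ ΣQ.sum-cong-≗ (λ j → cong (λ z → if toℕ j <ᵇ k then z else 0ℚ) (ℚP.+-identityʳ (Δ j))) ⟩
    prefix Δ k                      ≡⟨ prefix-telescoping g k≤r ⟩
    g k - g 0                       ≡⟨ cong (_-_ (g k)) g0≡0 ⟩
    g k - 0ℚ                        ≡⟨ ℚP.+-identityʳ (g k) ⟩
    g k                             ∎
    where
    open ≡-Reasoning
    Δ : Fin r → ℚ
    Δ j = g (suc (toℕ j)) - g (toℕ j)

  partialλ-witness : ∀ {k} → k ≤ r → partialλ witness k ≡ X k
  partialλ-witness = prefix-witness X (cong (λ n → - ι n) kinks-0)

  partialμ-witness : ∀ {k} → k ≤ r → partialμ witness k ≡ Y k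
  partialμ-witness = prefix-witness Y (cong (λ n → ι n - ι 0) kinks-0)

  module Proper {ℓ b a} (ℓ<b : ℓ < b) (b<a : b < a) (a≤r : a ≤ r) where

    P Q R : ℕ
    P = a ∸ ℓ
    Q = a ∸ b
    R = b ∸ ℓ

    excess : ℕ → ℕ
    excess k = Tent.excess (tent ℓ<b b<a k)

    tents : ℕ
    tents = ΣN.sum (λ (j : Fin r) → outside InU? (toℕ j) ℕ.* excess (toℕ j))

    penalty : ℕ
    penalty = P ℕ.* outside InB? b ℕ.+ (Q ℕ.* outside InE? ℓ ℕ.+ R ℕ.* outside InE? a) ℕ.+ tents

    kinks-split : P ℕ.* kinks b ≡ tents ℕ.+ (Q ℕ.* kinks ℓ ℕ.+ R ℕ.* kinks a)
    kinks-split = begin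
      P ℕ.* ΣN.sum (λ j → u j ℕ.* (toℕ j ⊓ b))
        ≡⟨ ΣN.*-distribˡ-sum P (λ j → u j ℕ.* (toℕ j ⊓ b)) ⟩
      ΣN.sum (λ j → P ℕ.* (u j ℕ.* (toℕ j ⊓ b)))
        ≡⟨ ΣN.sum-cong-≗ pointwise ⟩
      ΣN.sum (λ j → u j ℕ.* excess (toℕ j) ℕ.+ (Q ℕ.* (u j ℕ.* (toℕ j ⊓ ℓ)) ℕ.+ R ℕ.* (u j ℕ.* (toℕ j ⊓ a))))
        ≡⟨ ΣN.∑-distrib-+ (λ j → u j ℕ.* excess (toℕ j)) _ ⟩
      tents ℕ.+ ΣN.sum (λ j → Q ℕ.* (u j ℕ.* (toℕ j ⊓ ℓ)) ℕ.+ R ℕ.* (u j ℕ.* (toℕ j ⊓ a)))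
        ≡⟨ cong (tents ℕ.+_) (ΣN.∑-distrib-+ (λ j → Q ℕ.* (u j ℕ.* (toℕ j ⊓ ℓ))) (λ j → R ℕ.* (u j ℕ.* (toℕ j ⊓ a)))) ⟩
      tents ℕ.+ (ΣN.sum (λ j → Q ℕ.* (u j ℕ.* (toℕ j ⊓ ℓ))) ℕ.+ ΣN.sum (λ j → R ℕ.* (u j ℕ.* (toℕ j ⊓ a))))
        ≡⟨ cong₂ (λ x y → tents ℕ.+ (x ℕ.+ y)) (ΣN.*-distribˡ-sum Q (λ j → u j ℕ.* (toℕ j ⊓ ℓ)))
                                                (ΣN.*-distribˡ-sum R (λ j → u j ℕ.* (toℕ j ⊓ a))) ⟨
      tents ℕ.+ (Q ℕ.* kinks ℓ ℕ.+ R ℕ.* kinks a) ∎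
      where
      open ≡-Reasoning
      u : Fin r → ℕ
      u j = outside InU? (toℕ j)
      identity : ∀ P u x D Q y R z → P ℕ.* x ≡ D ℕ.+ (Q ℕ.* y ℕ.+ R ℕ.* z) →
                 P ℕ.* (u ℕ.* x) ≡ u ℕ.* D ℕ.+ (Q ℕ.* (u ℕ.* y) ℕ.+ R ℕ.* (u ℕ.* z))
      identity P u x D Q y R z eq = begin
        P ℕ.* (u ℕ.* x)                                   ≡⟨ swap P u x ⟩
        u ℕ.* (P ℕ.* x)                                   ≡⟨ cong (u ℕ.*_) eq ⟩
        u ℕ.* (D ℕ.+ (Q ℕ.* y ℕ.+ R ℕ.* z))               ≡⟨ distrib u D Q y R z ⟩
        u ℕ.* D ℕ.+ (Q ℕ.* (u ℕ.* y) ℕ.+ R ℕ.* (u ℕ.* z)) ∎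
        where
        swap : ∀ P u x → P ℕ.* (u ℕ.* x) ≡ u ℕ.* (P ℕ.* x)
        swap = ℕ-Solver.solve-∀
        distrib : ∀ u D Q y R z →
                  u ℕ.* (D ℕ.+ (Q ℕ.* y ℕ.+ R ℕ.* z)) ≡ u ℕ.* D ℕ.+ (Q ℕ.* (u ℕ.* y) ℕ.+ R ℕ.* (u ℕ.* z))
        distrib = ℕ-Solver.solve-∀
      pointwise : ∀ j → P ℕ.* (u j ℕ.* (toℕ j ⊓ b))
                        ≡ u j ℕ.* excess (toℕ j) ℕ.+ (Q ℕ.* (u j ℕ.* (toℕ j ⊓ ℓ)) ℕ.+ R ℕ.* (u j ℕ.* (toℕ j ⊓ a)))
      pointwise j = identity P (u j) _ _ Q _ R _ (Tent.split (tent ℓ<b b<a (toℕ j)))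

    ι-penalty : ι penalty ≡ ι P * ι (outside InB? b) + (ι Q * ι (outside InE? ℓ) + ι R * ι (outside InE? a)) + ι tents
    ι-penalty =
      trans (ι-+ (P ℕ.* outside InB? b ℕ.+ (Q ℕ.* outside InE? ℓ ℕ.+ R ℕ.* outside InE? a)) tents)
            (cong (_+ ι tents) (trans (ι-+ (P ℕ.* outside InB? b) (Q ℕ.* outside InE? ℓ ℕ.+ R ℕ.* outside InE? a))
                                      (cong₂ _+_ (ι-* P (outside InB? b)) (ι-affine Q (outside InE? ℓ) R (outside InE? a)))))
      where
      ι-affine : ∀ q x r y → ι (q ℕ.* x ℕ.+ r ℕ.* y) ≡ ι q * ι x + ι r * ι y
      ι-affine q x r y = trans (ι-+ (q ℕ.* x) (r ℕ.* y)) (cong₂ _+_ (ι-* q x) (ι-* r y))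

    ι-kinks-split : ι P * ι (kinks b) ≡ ι tents + (ι Q * ι (kinks ℓ) + ι R * ι (kinks a))
    ι-kinks-split = begin
      ι P * ι (kinks b)                                 ≡⟨ ι-* P (kinks b) ⟨
      ι (P ℕ.* kinks b)                                 ≡⟨ cong ι kinks-split ⟩
      ι (tents ℕ.+ (Q ℕ.* kinks ℓ ℕ.+ R ℕ.* kinks a))   ≡⟨ ι-+ tents (Q ℕ.* kinks ℓ ℕ.+ R ℕ.* kinks a) ⟩
      ι tents + ι (Q ℕ.* kinks ℓ ℕ.+ R ℕ.* kinks a)     ≡⟨ cong (_+_ (ι tents)) (trans (ι-+ (Q ℕ.* kinks ℓ) (R ℕ.* kinks a))
                                                                                       (cong₂ _+_ (ι-* Q (kinks ℓ)) (ι-* R (kinks a)))) ⟩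
      ι tents + (ι Q * ι (kinks ℓ) + ι R * ι (kinks a)) ∎
      where open ≡-Reasoning

    height : ι P * X b + (ι Q * Y ℓ + ι R * Y a) ≡ (0ℚ - ι penalty) * 1ℚ
    height = begin
      ι P * X b + (ι Q * Y ℓ + ι R * Y a)
        ≡⟨ cong (λ z → ι P * - z + (ι Q * Y ℓ + ι R * Y a)) (ι-+ (outside InB? b) (kinks b)) ⟩
      ι P * - (β + κb) + (ι Q * (κℓ - εℓ) + ι R * (κa - εa))
        ≡⟨ expand (ι P) (ι Q) (ι R) β εℓ εa κb κℓ κa ⟩
      (0ℚ - (ι P * β + (ι Q * εℓ + ι R * εa) + (ι P * κb - (ι Q * κℓ + ι R * κa)))) * 1ℚ
        ≡⟨ cong (λ z → (0ℚ - (ι P * β + (ι Q * εℓ + ι R * εa) + (z - (ι Q * κℓ + ι R * κa)))) * 1ℚ) ι-kinks-split ⟩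
      (0ℚ - (ι P * β + (ι Q * εℓ + ι R * εa) + (ι tents + (ι Q * κℓ + ι R * κa) - (ι Q * κℓ + ι R * κa)))) * 1ℚ
        ≡⟨ cong (λ z → (0ℚ - (ι P * β + (ι Q * εℓ + ι R * εa) + z)) * 1ℚ) (cancel (ι tents) (ι Q * κℓ + ι R * κa)) ⟩
      (0ℚ - (ι P * β + (ι Q * εℓ + ι R * εa) + ι tents)) * 1ℚ
        ≡⟨ cong (λ z → (0ℚ - z) * 1ℚ) ι-penalty ⟨
      (0ℚ - ι penalty) * 1ℚ ∎
      where
      open ≡-Reasoning
      β εℓ εa κb κℓ κa : ℚ
      β  = ι (outside InB? b)
      εℓ = ι (outside InE? ℓ)
      εa = ι (outside InE? a)
      κb = ι (kinks b)
      κℓ = ι (kinks ℓ)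
      κa = ι (kinks a)
      expand : ∀ p q r β εℓ εa κb κℓ κa →
               p * - (β + κb) + (q * (κℓ - εℓ) + r * (κa - εa))
                 ≡ (0ℚ - (p * β + (q * εℓ + r * εa) + (p * κb - (q * κℓ + r * κa)))) * 1ℚ
      expand = solve-∀ ℚ-ring
      cancel : ∀ x y → x + y - y ≡ x
      cancel = solve-∀ ℚ-ring

    eval-witness : (eval witness a b ℓ - d witness) * ι (genTotal r a b ℓ) ≡ (0ℚ - ι penalty) * 1ℚ
    eval-witness = begin
      (eval witness a b ℓ - d witness) * ι (genTotal r a b ℓ)
        ≡⟨ eval-proper witness ℓ<b b<a a≤r ⟩
      ι P * partialλ witness b + (ι Q * partialμ witness ℓ + ι R * partialμ witness a)
        ≡⟨ cong₂ (λ x y → ι P * x + y) (partialλ-witness (ℕP.≤-trans (ℕP.<⇒≤ b<a) a≤r))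
             (cong₂ (λ x y → ι Q * x + ι R * y) (partialμ-witness (ℕP.≤-trans (ℕP.<⇒≤ ℓ<a) a≤r)) (partialμ-witness a≤r)) ⟩
      ι P * X b + (ι Q * Y ℓ + ι R * Y a)
        ≡⟨ height ⟩
      (0ℚ - ι penalty) * 1ℚ ∎
      where
      open ≡-Reasoning
      ℓ<a : ℓ < a
      ℓ<a = ℕP.<-trans ℓ<b b<a

    tents≡0 : Covered as ls ℓ a → tents ≡ 0
    tents≡0 covered = all≡0⇒sum≡0 {r} (λ j → outside InU? (toℕ j) ℕ.* excess (toℕ j)) (λ j → vanishes (toℕ j))
      where
      vanishes : ∀ k → outside InU? k ℕ.* excess k ≡ 0
      vanishes k = [ (λ k≤ℓ → no-excess (inj₁ k≤ℓ))
                   , (λ ℓ<k → [ (λ k<a → cong (ℕ._* excess k) (outside-∈ InU? (covered⇒cover {bs = bs} covered k ℓ<k k<a)))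
                              , (λ a≤k → no-excess (inj₂ a≤k)) ]′ (ℕP.<-≤-connex k a))
                   ]′ (ℕP.≤-<-connex k ℓ)
        where
        no-excess : k ≤ ℓ ⊎ a ≤ k → outside InU? k ℕ.* excess k ≡ 0
        no-excess k≤ℓ∨a≤k = trans (cong (outside InU? k ℕ.*_) (Tent.excess-0 (tent ℓ<b b<a k) k≤ℓ∨a≤k))
                                        (ℕP.*-zeroʳ (outside InU? k))

    conditions⇒penalty≡0 : Conditions m as bs ls a b ℓ → penalty ≡ 0
    conditions⇒penalty≡0 (b∈B , ℓ∈E , a∈E , covered) =
      cong₂ ℕ._+_ (cong₂ ℕ._+_ (absorb P (outside-∈ InB? b∈B))
                               (cong₂ ℕ._+_ (absorb Q (outside-∈ InE? ℓ∈E)) (absorb R (outside-∈ InE? a∈E))))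
                  (tents≡0 covered)
      where
      absorb : ∀ c {x} → x ≡ 0 → c ℕ.* x ≡ 0
      absorb c x≡0 = trans (cong (c ℕ.*_) x≡0) (ℕP.*-zeroʳ c)

    penalty≡0⇒conditions : penalty ≡ 0 → Conditions m as bs ls a b ℓ
    penalty≡0⇒conditions penalty≡0 = b∈B , ℓ∈E ℓ refl , a∈E , cover⇒covered {bs = bs} (ℕP.≤-<-trans ℓ<b b<a) cover
      where
      front≡0 : P ℕ.* outside InB? b ℕ.+ (Q ℕ.* outside InE? ℓ ℕ.+ R ℕ.* outside InE? a) ≡ 0
      front≡0 = ℕP.m+n≡0⇒m≡0 _ penalty≡0
      ends≡0 : Q ℕ.* outside InE? ℓ ℕ.+ R ℕ.* outside InE? a ≡ 0
      ends≡0 = ℕP.m+n≡0⇒n≡0 (P ℕ.* outside InB? b) front≡0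
      b∈B : InB as bs ls b
      b∈B = outside-≡0⇒∈ InB? (ℕP.≤-<-trans z≤n ℓ<b)
              (*≡0⇒≡0 (ℕP.m<n⇒0<n∸m (ℕP.<-trans ℓ<b b<a)) (ℕP.m+n≡0⇒m≡0 _ front≡0))
      a∈E : InE as bs ls a
      a∈E = outside-≡0⇒∈ InE? (ℕP.≤-<-trans z≤n (ℕP.<-trans ℓ<b b<a))
              (*≡0⇒≡0 (ℕP.m<n⇒0<n∸m ℓ<b) (ℕP.m+n≡0⇒n≡0 (Q ℕ.* outside InE? ℓ) ends≡0))
      cover : InteriorCover as bs ls ℓ a
      cover k ℓ<k k<a = outside-≡0⇒∈ InU? (ℕP.≤-<-trans z≤n ℓ<k)
        (*≡0⇒≡0 (Tent.excess-pos (tent ℓ<b b<a k) ℓ<k k<a) (trans (ℕP.*-comm (excess k) _) term≡0))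
        where
        k<r : k < r
        k<r = ℕP.<-≤-trans k<a a≤r
        term≡0 : outside InU? k ℕ.* excess k ≡ 0
        term≡0 = subst (λ n → outside InU? n ℕ.* excess n ≡ 0) (toℕ-fromℕ< k<r)
                   (sum≡0⇒all≡0 (λ j → outside InU? (toℕ j) ℕ.* excess (toℕ j)) (ℕP.m+n≡0⇒n≡0 _ penalty≡0) (fromℕ< k<r))
      -- ℓ = 0 is never penalised, but then the cover of (0, a) at 1 forces some ℓᵢ = 0.
      ℓ∈E : ∀ q → q ≡ ℓ → InE as bs ls q
      ℓ∈E zero    0≡ℓ with cover 1 (subst (_< 1) 0≡ℓ (s≤s z≤n))
                                   (subst (λ q → suc q < a) (sym 0≡ℓ) (ℕP.≤-<-trans ℓ<b b<a))
      ... | i , ℓᵢ<1 , _ = i , inj₁ (sym (ℕP.n<1⇒n≡0 ℓᵢ<1))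
      ℓ∈E (suc q) refl = outside-≡0⇒∈ InE? (s≤s z≤n)
                           (*≡0⇒≡0 (ℕP.m<n⇒0<n∸m b<a) (ℕP.m+n≡0⇒m≡0 (Q ℕ.* outside InE? ℓ) ends≡0))

  module Diagonal {a} (1≤a : 1 ≤ a) (a≤r : a ≤ r) where

    penalty : ℕ
    penalty = a ℕ.* (outside InB? a ℕ.+ outside InE? a)

    eval-witness : (eval witness a a a - d witness) * ι (genTotal r a a a) ≡ (0ℚ - ι penalty) * 1ℚ
    eval-witness = begin
      (eval witness a a a - d witness) * ι (genTotal r a a a)  ≡⟨ eval-diagonal witness 1≤a a≤r ⟩
      ι a * (partialλ witness a + partialμ witness a)          ≡⟨ cong₂ (λ x y → ι a * (x + y)) (partialλ-witness a≤r) (partialμ-witness a≤r) ⟩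
      ι a * (- ι (outside InB? a ℕ.+ kinks a) + Y a)           ≡⟨ cong (λ z → ι a * (- z + Y a)) (ι-+ (outside InB? a) (kinks a)) ⟩
      ι a * (- (β + κ) + (κ - ε))                               ≡⟨ identity (ι a) β κ ε ⟩
      (0ℚ - ι a * (β + ε)) * 1ℚ                                ≡⟨ cong (λ z → (0ℚ - z) * 1ℚ) ι-penalty ⟨
      (0ℚ - ι penalty) * 1ℚ                                    ∎
      where
      open ≡-Reasoning
      β κ ε : ℚ
      β = ι (outside InB? a)
      κ = ι (kinks a)
      ε = ι (outside InE? a)
      identity : ∀ a β κ ε → a * (- (β + κ) + (κ - ε)) ≡ (0ℚ - a * (β + ε)) * 1ℚ
      identity = solve-∀ ℚ-ring
      ι-penalty : ι penalty ≡ ι a * (β + ε)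
      ι-penalty = trans (ι-* a _) (cong (ι a *_) (ι-+ (outside InB? a) (outside InE? a)))

    conditions⇒penalty≡0 : Conditions m as bs ls a a a → penalty ≡ 0
    conditions⇒penalty≡0 (a∈B , _ , a∈E , _) =
      trans (cong₂ (λ x y → a ℕ.* (x ℕ.+ y)) (outside-∈ InB? a∈B) (outside-∈ InE? a∈E)) (ℕP.*-zeroʳ a)

    penalty≡0⇒conditions : penalty ≡ 0 → Conditions m as bs ls a a a
    penalty≡0⇒conditions penalty≡0 = a∈B , a∈E , a∈E , λ _ a<x x<a → ⊥-elim (ℚP.<-asym a<x x<a)
      where
      missing≡0 : outside InB? a ℕ.+ outside InE? a ≡ 0
      missing≡0 = *≡0⇒≡0 1≤a penalty≡0
      a∈B : InB as bs ls a
      a∈B = outside-≡0⇒∈ InB? 1≤a (ℕP.m+n≡0⇒m≡0 _ missing≡0)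
      a∈E : InE as bs ls a
      a∈E = outside-≡0⇒∈ InE? 1≤a (ℕP.m+n≡0⇒n≡0 (outside InB? a) missing≡0)

  penalty : ∀ {a b ℓ} → Label r a b ℓ → ℕ
  penalty (proper ℓ<b b<a a≤r) = Proper.penalty ℓ<b b<a a≤r
  penalty (diagonal 1≤a a≤r)   = Diagonal.penalty 1≤a a≤r

  eval-witness : ∀ {a b ℓ} (L : Label r a b ℓ) →
                 (eval witness a b ℓ - d witness) * ι (genTotal r a b ℓ) ≡ (0ℚ - ι (penalty L)) * 1ℚ
  eval-witness (proper ℓ<b b<a a≤r) = Proper.eval-witness ℓ<b b<a a≤r
  eval-witness (diagonal 1≤a a≤r)   = Diagonal.eval-witness 1≤a a≤r

  penalty≡0⇔conditions : ∀ {a b ℓ} (L : Label r a b ℓ) → penalty L ≡ 0 ⇔ Conditions m as bs ls a b ℓ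
  penalty≡0⇔conditions (proper ℓ<b b<a a≤r) =
    mk⇔ (Proper.penalty≡0⇒conditions ℓ<b b<a a≤r) (Proper.conditions⇒penalty≡0 ℓ<b b<a a≤r)
  penalty≡0⇔conditions (diagonal 1≤a a≤r)   =
    mk⇔ (Diagonal.penalty≡0⇒conditions 1≤a a≤r) (Diagonal.conditions⇒penalty≡0 1≤a a≤r)

  witness-supporting : Supporting r witness
  witness-supporting a b ℓ lab =
    Equivalence.from (sign-≤ (ι-mono-< (genTotal-pos (label lab))) (ι-pos 0) (eval-witness (label lab))) (ι-nonNeg (penalty (label lab)))

  witness-face : ∀ {a b ℓ} → IsLabel r a b ℓ → OnFace witness a b ℓ ⇔ Conditions m as bs ls a b ℓ
  witness-face lab = ⇔.trans (sign-≡ (ι-mono-< (genTotal-pos (label lab))) (ι-pos 0) (eval-witness (label lab)))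
                     (⇔.trans (mk⇔ (λ 0≡ιn → ι-injective (sym 0≡ιn)) (λ n≡0 → sym (cong ι n≡0)))
                              (penalty≡0⇔conditions (label lab)))

-- Supporting functionals

module Supported {r} (f : Functional r) (supporting : Supporting r f) where

  ψ φ : ℕ → ℚ
  ψ = partialλ f
  φ k = - partialμ f k

  proper-height : ∀ {a b ℓ} → ℓ < b → b < a → a ≤ r →
                  (eval f a b ℓ - d f) * ι (genTotal r a b ℓ) ≡ (ψ b - chord φ ℓ a (ι b)) * (ι a - ι ℓ)
  proper-height {a} {b} {ℓ} ℓ<b b<a a≤r = begin
    (eval f a b ℓ - d f) * ι (genTotal r a b ℓ)
      ≡⟨ eval-proper f ℓ<b b<a a≤r ⟩
    ι (a ∸ ℓ) * ψ b + (ι (a ∸ b) * partialμ f ℓ + ι (b ∸ ℓ) * partialμ f a)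
      ≡⟨ cong₂ (λ x y → x * ψ b + y) (ι-∸ (ℕP.<⇒≤ ℓ<a))
               (cong₂ (λ x y → x * partialμ f ℓ + y * partialμ f a) (ι-∸ (ℕP.<⇒≤ b<a)) (ι-∸ (ℕP.<⇒≤ ℓ<b))) ⟩
    (ι a - ι ℓ) * ψ b + ((ι a - ι b) * partialμ f ℓ + (ι b - ι ℓ) * partialμ f a)
      ≡⟨ negate (ι a) (ι b) (ι ℓ) (ψ b) (partialμ f ℓ) (partialμ f a) ⟩
    (ι a - ι ℓ) * ψ b - ((ι a - ι b) * φ ℓ + (ι b - ι ℓ) * φ a)
      ≡⟨ cong (_-_ ((ι a - ι ℓ) * ψ b)) (chord-interpolates φ ℓ<a (ι b)) ⟨
    (ι a - ι ℓ) * ψ b - (ι a - ι ℓ) * chord φ ℓ a (ι b)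
      ≡⟨ factor (ι a - ι ℓ) (ψ b) (chord φ ℓ a (ι b)) ⟩
    (ψ b - chord φ ℓ a (ι b)) * (ι a - ι ℓ) ∎
    where
    open ≡-Reasoning
    ℓ<a : ℓ < a
    ℓ<a = ℕP.<-trans ℓ<b b<a
    negate : ∀ a b l x y z → (a - l) * x + ((a - b) * y + (b - l) * z) ≡ (a - l) * x - ((a - b) * - y + (b - l) * - z)
    negate = solve-∀ ℚ-ring
    factor : ∀ s x c → s * x - s * c ≡ (x - c) * s
    factor = solve-∀ ℚ-ring

  diagonal-height : ∀ {a} → 1 ≤ a → a ≤ r → (eval f a a a - d f) * ι (genTotal r a a a) ≡ (ψ a - φ a) * ι a
  diagonal-height {a} 1≤a a≤r = trans (eval-diagonal f 1≤a a≤r) (identity (ι a) (ψ a) (partialμ f a))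
    where
    identity : ∀ a x y → a * (x + y) ≡ (x - - y) * a
    identity = solve-∀ ℚ-ring

  ψ≤chord : ∀ {ℓ b a} → ℓ < b → b < a → a ≤ r → ψ b ℚ.≤ chord φ ℓ a (ι b)
  ψ≤chord ℓ<b b<a a≤r =
    Equivalence.to (sign-≤ (ι-mono-< (genTotal-pos (proper ℓ<b b<a a≤r))) (<⇒0<- (ι-mono-< (ℕP.<-trans ℓ<b b<a)))
                           (proper-height ℓ<b b<a a≤r))
                   (supporting _ _ _ (inj₁ (ℓ<b , b<a , a≤r)))

  ψ≤φ : ∀ {a} → 1 ≤ a → a ≤ r → ψ a ℚ.≤ φ a
  ψ≤φ 1≤a a≤r =
    Equivalence.to (sign-≤ (ι-mono-< (genTotal-pos (diagonal 1≤a a≤r))) (ι-mono-< 1≤a) (diagonal-height 1≤a a≤r))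
                   (supporting _ _ _ (inj₂ (refl , refl , 1≤a , a≤r)))

  onFace⇔touches : ∀ {a b ℓ} → ℓ < b → b < a → a ≤ r → OnFace f a b ℓ ⇔ ψ b ≡ chord φ ℓ a (ι b)
  onFace⇔touches ℓ<b b<a a≤r =
    sign-≡ (ι-mono-< (genTotal-pos (proper ℓ<b b<a a≤r))) (<⇒0<- (ι-mono-< (ℕP.<-trans ℓ<b b<a))) (proper-height ℓ<b b<a a≤r)

  onFace⇔ψ≡φ : ∀ {a} → 1 ≤ a → a ≤ r → OnFace f a a a ⇔ ψ a ≡ φ a
  onFace⇔ψ≡φ 1≤a a≤r = sign-≡ (ι-mono-< (genTotal-pos (diagonal 1≤a a≤r))) (ι-mono-< 1≤a) (diagonal-height 1≤a a≤r)

  open Envelope r ψ φ ψ≤chord ψ≤φ public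

  tight-label : ∀ {a b ℓ} → Label r a b ℓ → OnFace f a b ℓ → TightLabel a b ℓ
  tight-label (proper ℓ<b b<a a≤r) on-face =
    proper (record { ℓ<b = ℓ<b ; b<a = b<a ; a≤r = a≤r ; touches = Equivalence.to (onFace⇔touches ℓ<b b<a a≤r) on-face })
  tight-label (diagonal 1≤a a≤r)   on-face = diagonal 1≤a a≤r (Equivalence.to (onFace⇔ψ≡φ 1≤a a≤r) on-face)

  conditions⇒onFace : ∀ {m} {as bs ls : Fin m → ℕ} →
                      (∀ i → Label r (as i) (bs i) (ls i)) → (∀ i → OnFace f (as i) (bs i) (ls i)) →
                      ∀ {a b ℓ} → Label r a b ℓ → Conditions m as bs ls a b ℓ → OnFace f a b ℓ
  conditions⇒onFace {bs = bs} labels on-face (proper ℓ<b b<a a≤r) (b∈B , ℓ∈E , a∈E , covered) =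
    Equivalence.from (onFace⇔touches ℓ<b b<a a≤r)
      (Tight.touches (proper-tight (λ i → tight-label (labels i) (on-face i)) ℓ<b b<a a≤r b∈B ℓ∈E a∈E
                                   (covered⇒cover {bs = bs} covered)))
  conditions⇒onFace labels on-face (diagonal 1≤a a≤r) (a∈B , _ , a∈E , _) =
    Equivalence.from (onFace⇔ψ≡φ 1≤a a≤r) (diagonal-tight (λ i → tight-label (labels i) (on-face i)) 1≤a a≤r a∈B a∈E)

proposition4p1 : (r : ℕ) → 1 ≤ r → (m : ℕ) → (as bs ls : Fin m → ℕ)
  → (∀ i → IsLabel r (as i) (bs i) (ls i))
  → (Σ (Functional r) (λ f → Supporting r f
        × (∀ i → OnFace f (as i) (bs i) (ls i))
        × (∀ a b ℓ → IsLabel r a b ℓ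
             → (Conditions m as bs ls a b ℓ → OnFace f a b ℓ)
               × (OnFace f a b ℓ → Conditions m as bs ls a b ℓ))))
    × (∀ (f : Functional r) → Supporting r f
        → (∀ i → OnFace f (as i) (bs i) (ls i))
        → ∀ a b ℓ → IsLabel r a b ℓ → Conditions m as bs ls a b ℓ → OnFace f a b ℓ)
proposition4p1 r _ m as bs ls labels =
    ( witness
    , witness-supporting
    , (λ i → Equivalence.from (witness-face (labels i)) (own-conditions i))
    , (λ a b ℓ lab → Equivalence.from (witness-face lab) , Equivalence.to (witness-face lab)) )
  , (λ f supporting on-face a b ℓ lab →
       Supported.conditions⇒onFace f supporting (λ i → label (labels i)) on-face (label lab))
  where
  open Witness r as bs ls
  own-conditions : ∀ i → Conditions m as bs ls (as i) (bs i) (ls i)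
  own-conditions i = (i , refl) , (i , inj₁ refl) , (i , inj₂ refl) , (λ x ℓᵢ<x x<aᵢ → i , ℓᵢ<x , x<aᵢ)
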